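{- Let $D$ be a double poset on a finite set $N$ and let $\mathfrak{G}\subseteq\operatorname{Aut}(D)$. Then: (1) for each $\mathfrak{g}\in\mathfrak{G}$, $\Omega(D,\mathfrak{G},\mathbf{x};\mathfrak{g})=\sum_{C}M_{\alpha(C)}$, the sum over $D$-set compositions $C$ with $\mathfrak{g}C=C$; (2) $\Omega(D,\mathfrak{G},\mathbf{x})=\sum_{\alpha\models|N|}\chi_{\alpha,D}M_\alpha$; (3) $\Omega(D,\mathfrak{G},x)=\sum_{\alpha\models|N|}\chi_{\alpha,D}\binom{x}{\ell(\alpha)}$.
   Context: Double poset $D=(N,\le_1,\le_2)$; $\operatorname{Aut}(D)$ = bijections preserving both orders. A $D$-partition is $f:N\to\{1,2,\dots\}$ with $i\le_1 j\Rightarrow f(i)\le f(j)$ and ($i<_1 j$ and $j<_2 i$) $\Rightarrow f(i)<f(j)$. $\Omega(D,\mathfrak{G},\mathbf{x};\mathfrak{g})=\sum_f\prod_v x_{f(v)}$ over $D$-partitions with $f\circ\mathfrak{g}=f$; for positive integers $n$, $\Omega(D,\mathfrak{G},n)$ is the permutation character of $\mathfrak{G}$ on the set of $D$-partitions with values in $\{1,\dots,n\}$, and $\Omega(D,\mathfrak{G},x)$ denotes this as a function of $x$ (identity (3) is meant at all positive integers $x$). A set composition of $N$ is a sequence $C=C_1|\cdots|C_k$ of disjoint nonempty blocks with union $N$; its type is $\alpha(C)=(|C_1|,\dots,|C_k|)$, $\ell(\alpha)$ is the number of parts, and $\mathfrak{g}C=\mathfrak{g}(C_1)|\cdots|\mathfrak{g}(C_k)$.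 An inversion is a pair $(m,m')$ with $m<_1 m'$ and $m'<_2 m$. $C$ is a $D$-set composition if each $C_1\cup\cdots\cup C_i$ is a down-set of $\le_1$ and no block contains an inversion. $\chi_{\alpha,D}$ is the permutation character of $\mathfrak{G}$ acting on the set $X_{\alpha,D}$ of $D$-set compositions of type $\alpha$. $M_\alpha$ are monomial quasisymmetric functions. -}

module Defs where

open import Level using (0ℓ)
open import Data.Nat using (ℕ; zero; suc; _+_; _*_)
open import Data.Bool using (Bool; true; false)
import Data.Bool.Properties as BoolP
open import Data.Fin using (Fin; toℕ; _<_; _≤_)
open import Data.Fin.Properties using (all?; any?; _≤?_; _<?_)
import Data.Fin.Properties as FinP
open import Data.Fin.Subset using (Subset; _∈_; ⋃; ∣_∣; Nonempty)
open import Data.Fin.Subset.Properties using (_∈?_; nonempty?)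
open import Data.Fin.Permutation using (Permutation′; _⟨$⟩ʳ_; _⟨$⟩ˡ_; id; flip; _∘ₚ_)
open import Data.Vec using (Vec; []; _∷_; toList; tabulate; lookup)
import Data.Vec as Vec
import Data.Vec.Properties as VecP
import Data.Vec.Functional as VF
open import Data.List using (List; []; _∷_; length; map; concatMap; filter; allFin; upTo; take; foldr)
open import Data.Nat.ListAction public using (sum)
import Data.List.Relation.Unary.All as All
open import Data.Product using (_×_; _,_; Σ; ∃)
open import Relation.Binary using (Rel; IsDecPartialOrder; Decidable)
open import Relation.Binary.PropositionalEquality using (_≡_; refl)
open import Relation.Nullary using (Dec; yes; no; ¬_; does)
open import Relation.Nullary.Decidable using (_×-dec_; _→-dec_; ¬?)
import Data.Nat.Properties as NatP
import Data.List.Properties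
import Data.Nat

record DoublePoset (n : ℕ) : Set₁ where
  field
    _≤₁_ : Rel (Fin n) 0ℓ
    _≤₂_ : Rel (Fin n) 0ℓ
    isDecPartialOrder₁ : IsDecPartialOrder _≡_ _≤₁_
    isDecPartialOrder₂ : IsDecPartialOrder _≡_ _≤₂_

  _<₁_ : Rel (Fin n) 0ℓ
  i <₁ j = i ≤₁ j × ¬ (i ≡ j)

  _<₂_ : Rel (Fin n) 0ℓ
  i <₂ j = i ≤₂ j × ¬ (i ≡ j)

  _≤₁?_ : Decidable _≤₁_
  _≤₁?_ = IsDecPartialOrder._≤?_ isDecPartialOrder₁

  _≤₂?_ : Decidable _≤₂_
  _≤₂?_ = IsDecPartialOrder._≤?_ isDecPartialOrder₂

  _<₁?_ : Decidable _<₁_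
  i <₁? j = (i ≤₁? j) ×-dec ¬? (i FinP.≟ j)

  _<₂?_ : Decidable _<₂_
  i <₂? j = (i ≤₂? j) ×-dec ¬? (i FinP.≟ j)

  Inversion : Fin n → Fin n → Set
  Inversion m m' = m <₁ m' × m' <₂ m

  inversion? : ∀ m m' → Dec (Inversion m m')
  inversion? m m' = (m <₁? m') ×-dec (m' <₂? m)

open DoublePoset public

IsAut : ∀ {n} → DoublePoset n → Permutation′ n → Set
IsAut D g = (∀ v w → _≤₁_ D v w → _≤₁_ D (g ⟨$⟩ʳ v) (g ⟨$⟩ʳ w))
          × (∀ v w → _≤₂_ D v w → _≤₂_ D (g ⟨$⟩ʳ v) (g ⟨$⟩ʳ w))

record SubgroupOfAut {n : ℕ} (D : DoublePoset n) : Set₁ where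
  field
    _∈𝔊 : Permutation′ n → Set
    ⊆Aut : ∀ g → g ∈𝔊 → IsAut D g
    id∈ : id ∈𝔊
    ∘∈ : ∀ g h → g ∈𝔊 → h ∈𝔊 → (g ∘ₚ h) ∈𝔊
    inv∈ : ∀ g → g ∈𝔊 → flip g ∈𝔊

open SubgroupOfAut public

count : ∀ {A : Set} {P : A → Set} → (∀ x → Dec (P x)) → List A → ℕ
count P? xs = length (filter P? xs)

allFuns : ∀ n k → List (Fin n → Fin k)
allFuns zero    k = (λ ()) ∷ []
allFuns (suc n) k = concatMap (λ f → map (λ a → a VF.∷ f) (allFin k)) (allFuns n k)

allSubsets : ∀ n → List (Subset n)
allSubsets zero    = [] ∷ []
allSubsets (suc n) = concatMap (λ s → (false ∷ s) ∷ (true ∷ s) ∷ []) (allSubsets n)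

allSubsetVecs : ∀ n k → List (Vec (Subset n) k)
allSubsetVecs n zero    = [] ∷ []
allSubsetVecs n (suc k) =
  concatMap (λ B → map (λ s → s ∷ B) (allSubsets n)) (allSubsetVecs n k)

allLists : ℕ → ℕ → List (List ℕ)
allLists zero    b = [] ∷ []
allLists (suc k) b = concatMap (λ l → map (λ a → a ∷ l) (upTo (suc b))) (allLists k b)

IsComposition : ℕ → List ℕ → Set
IsComposition m α = All.All (λ a → 0 Data.Nat.< a) α × sum α ≡ m

isComposition? : ∀ m α → Dec (IsComposition m α)
isComposition? m α = All.all? (λ a → 0 NatP.<? a) α ×-dec (sum α NatP.≟ m)

compositions : ℕ → List (List ℕ)
compositions m =
  filter (isComposition? m) (concatMap (λ k → allLists k m) (upTo (suc m)))

ℓ : List ℕ → ℕ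
ℓ = length

-- Formal power series in x₁, x₂, … with ℕ coefficients.
-- A monomial x₁^{m₁}⋯x_k^{m_k} is given by its exponent list (m₁ ,…, m_k)
-- (trailing zeros allowed; all definitions below respect them).

Monomial : Set
Monomial = List ℕ

PowerSeries : Set
PowerSeries = Monomial → ℕ

_≈PS_ : PowerSeries → PowerSeries → Set
F ≈PS G = ∀ m → F m ≡ G m

ΣPS : ∀ {A : Set} → List A → (A → PowerSeries) → PowerSeries
ΣPS xs F m = sum (map (λ a → F a m) xs)

_·PS_ : ℕ → PowerSeries → PowerSeries
(c ·PS F) m = c * F m

nonzeroExps : Monomial → List ℕ
nonzeroExps []            = []
nonzeroExps (zero  ∷ m)   = nonzeroExps m
nonzeroExps (suc a ∷ m)   = suc a ∷ nonzeroExps m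

-- monomial quasisymmetric function M_α = Σ_{i₁<⋯<i_k} x_{i₁}^{α₁}⋯x_{i_k}^{α_k}
M : List ℕ → PowerSeries
M α m with Data.List.Properties.≡-dec NatP._≟_ (nonzeroExps m) α
... | yes _ = 1
... | no  _ = 0

-- D-partitions.  A map N → {1,…,k} is represented as f : Fin n → Fin k,
-- the value i : Fin k standing for the positive integer toℕ i + 1.

module _ {n : ℕ} (D : DoublePoset n) where

  IsDPartition : ∀ {k} → (Fin n → Fin k) → Set
  IsDPartition f = ∀ i j →
      (_≤₁_ D i j → f i ≤ f j)
    × (_<₁_ D i j → _<₂_ D j i → f i < f j)

  isDPartition? : ∀ {k} (f : Fin n → Fin k) → Dec (IsDPartition f)
  isDPartition? f = all? λ i → all? λ j →
      (_≤₁?_ D i j →-dec (f i ≤? f j))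
    ×-dec (_<₁?_ D i j →-dec (_<₂?_ D j i →-dec (f i <? f j)))

  FixedBy : ∀ {k} → Permutation′ n → (Fin n → Fin k) → Set
  FixedBy g f = ∀ v → f (g ⟨$⟩ʳ v) ≡ f v

  fixedBy? : ∀ {k} g (f : Fin n → Fin k) → Dec (FixedBy g f)
  fixedBy? g f = all? λ v → f (g ⟨$⟩ʳ v) FinP.≟ f v

  fibre : ∀ {k} → (Fin n → Fin k) → Fin k → Subset n
  fibre f i = tabulate (λ v → does (f v FinP.≟ i))

  -- ∏_v x_{f(v)} = x^m   (m of length k)
  HasContent : (m : Monomial) → (Fin n → Fin (length m)) → Set
  HasContent m f = ∀ i → ∣ fibre f i ∣ ≡ Data.List.lookup m i

  hasContent? : ∀ m f → Dec (HasContent m f)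
  hasContent? m f = all? λ i → ∣ fibre f i ∣ NatP.≟ Data.List.lookup m i

  -- Ω(D,𝔊,x;g) = Σ_{D-partitions f, f∘g = f} ∏_v x_{f(v)}
  Ω : Permutation′ n → PowerSeries
  Ω g m = count (λ f → isDPartition? f ×-dec (fixedBy? g f ×-dec hasContent? m f))
                (allFuns n (length m))

  Ωₓ : ℕ → Permutation′ n → ℕ
  Ωₓ x g = count (λ f → isDPartition? f ×-dec fixedBy? g f) (allFuns n x)

  IsSetComposition : ∀ {k} → Vec (Subset n) k → Set
  IsSetComposition C =
      (∀ i → Nonempty (lookup C i))
    × (∀ i j v → v ∈ lookup C i → v ∈ lookup C j → i ≡ j)
    × (∀ v → ∃ λ i → v ∈ lookup C i)

  isSetComposition? : ∀ {k} (C : Vec (Subset n) k) → Dec (IsSetComposition C)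
  isSetComposition? C =
        all? (λ i → nonempty? (lookup C i))
    ×-dec all? (λ i → all? λ j → all? λ v →
            (v ∈? lookup C i) →-dec ((v ∈? lookup C j) →-dec (i FinP.≟ j)))
    ×-dec all? (λ v → any? (λ i → v ∈? lookup C i))

  IsDownSet : Subset n → Set
  IsDownSet S = ∀ v w → w ∈ S → _≤₁_ D v w → v ∈ S

  isDownSet? : ∀ S → Dec (IsDownSet S)
  isDownSet? S = all? λ v → all? λ w → (w ∈? S) →-dec (_≤₁?_ D v w →-dec (v ∈? S))

  IsDSetComposition : ∀ {k} → Vec (Subset n) k → Set
  IsDSetComposition {k} C =
      IsSetComposition C
    × (∀ (p : Fin (suc k)) → IsDownSet (⋃ (take (toℕ p) (toList C))))
    × (∀ i m m' → m ∈ lookup C i → m' ∈ lookup C i → ¬ Inversion D m m')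

  isDSetComposition? : ∀ {k} (C : Vec (Subset n) k) → Dec (IsDSetComposition C)
  isDSetComposition? {k} C =
        isSetComposition? C
    ×-dec all? (λ p → isDownSet? (⋃ (take (toℕ p) (toList C))))
    ×-dec all? (λ i → all? λ m → all? λ m' →
            (m ∈? lookup C i) →-dec ((m' ∈? lookup C i) →-dec ¬? (inversion? D m m')))

  type : ∀ {k} → Vec (Subset n) k → List ℕ
  type C = toList (Vec.map ∣_∣ C)

  image : Permutation′ n → Subset n → Subset n
  image g S = tabulate (λ w → lookup S (g ⟨$⟩ˡ w))

  act : ∀ {k} → Permutation′ n → Vec (Subset n) k → Vec (Subset n) k
  act g C = Vec.map (image g) C

  actFixed? : ∀ {k} g (C : Vec (Subset n) k) → Dec (act g C ≡ C)
  actFixed? g C = VecP.≡-dec (VecP.≡-dec BoolP._≟_) (act g C) C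

  fixedDSetCompositions : Permutation′ n → (k : ℕ) → List (Vec (Subset n) k)
  fixedDSetCompositions g k =
    filter (λ C → isDSetComposition? C ×-dec actFixed? g C) (allSubsetVecs n k)

  -- Σ_{D-set compositions C with 𝔤C = C} M_{α(C)}
  -- (a set composition of an n-set has at most n blocks, so k ranges over 0..n)
  ΣfixedM : Permutation′ n → PowerSeries
  ΣfixedM g m = sum (map (λ k → ΣPS (fixedDSetCompositions g k) (λ C → M (type C)) m)
                         (upTo (suc n)))

  χ : List ℕ → Permutation′ n → ℕ
  χ α g = count (λ C → isDSetComposition? C ×-dec
                        (actFixed? g C ×-dec Data.List.Properties.≡-dec NatP._≟_ (type C) α))
                (allSubsetVecs n (length α))

-- A D-partition f : N → {1,…,x} is determined by its sequence of fibres (f⁻¹(1), …, f⁻¹(x)):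
-- possibly empty blocks that partition N, are ordered along ≤₁ and contain no inversion. The map f
-- is fixed by 𝔤 iff this sequence is, and the content of f is the type of the sequence. Deleting
-- the empty blocks (peeling off one block at a time) matches the 𝔤-fixed sequences of type m with
-- the 𝔤-fixed D-set compositions of type nonzeroExps m, so the coefficient of x^m in Ω(D,𝔊,x;𝔤)
-- is χ_{nonzeroExps m,D}(𝔤). This is (2), and (1) is the same count grouped by number of blocks.
-- For (3), Ω(D,𝔊,x)(𝔤) is the sum of the coefficients of the monomials in x₁, …, x_x, and
-- summing M_α over them gives (x choose ℓ(α)).

module Submission where

open import Defs
open import Data.Nat using (ℕ; _*_; _<_)
open import Data.Nat.Combinatorics using (_C_)
open import Data.List using (map)
open import Data.Product using (_×_)
open import Relation.Binary.PropositionalEquality using (_≡_)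

open import Data.Bool using (Bool; true; false; if_then_else_)
import Data.Bool.Properties as Bool
open import Data.Empty using (⊥-elim)
open import Data.Fin using (Fin; toℕ)
import Data.Fin as Fin
import Data.Fin.Properties as Fin
open import Data.Fin.Properties using (all?; any?)
open import Data.Fin.Permutation using (Permutation′; _⟨$⟩ʳ_; _⟨$⟩ˡ_; inverseˡ; inverseʳ)
open import Data.Fin.Subset using (Subset; _∈_; _∉_; _∪_; ⋃; ∣_∣; ⊥; Nonempty)
open import Data.Fin.Subset.Properties
  using (_∈?_; ∪-identityʳ; ∣p∣≤n; nonempty?; Empty-unique; ∉⊥; ∈⊤; ∣⊤∣≡n; ∣⊥∣≡0; ⊆-antisym;
         x∈p⇒∣p-x∣<∣p∣; x∈p∪q⁻; x∈p∪q⁺)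
open import Data.List using (List; []; _∷_; _++_; concatMap; filter; length; upTo; allFin; take)
import Data.List as List
import Data.List.Properties as List
open import Data.List.Relation.Unary.All using (All; []; _∷_)
import Data.List.Relation.Unary.All as All
import Data.List.Relation.Unary.All.Properties as All
open import Data.Nat using (zero; suc; _+_; _≤_; z≤n; s≤s; s≤s⁻¹)
import Data.Nat.Properties as ℕ
open import Algebra.Properties.CommutativeSemigroup ℕ.+-commutativeSemigroup using (interchange)
open import Data.Nat.Combinatorics using (nCk+nC[k+1]≡[n+1]C[k+1])
open import Data.Nat.ListAction.Properties using (sum-++)
open import Data.Product using (_,_; proj₁; proj₂; ∃)
open import Data.Product.Function.NonDependent.Propositional using (_×-⇔_)
open import Data.Sum using (_⊎_; inj₁; inj₂)
open import Data.Vec using (Vec; []; _∷_; lookup; tabulate; toList; here; there)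
import Data.Vec as Vec
import Data.Vec.Properties as Vec
import Data.Vec.Functional as VF
open import Function using (_∘_)
open import Function.Bundles using (_⇔_; mk⇔; module Equivalence)
import Function.Properties.Equivalence as ⇔
open import Relation.Binary using (DecidableEquality)
open import Relation.Binary.PropositionalEquality
  using (refl; sym; trans; cong; cong₂; subst; subst₂; module ≡-Reasoning)
open import Relation.Nullary using (Dec; yes; no; ¬_; does)
open import Relation.Nullary.Decidable using (_×-dec_; _→-dec_; _⊎-dec_; ¬?; map′; does-⇔; dec-true)

-- Defined through `does`, so that 𝟙 computes through `map′`: for instance
-- 𝟙 ((x ∷ xs) ≟ (y ∷ ys)) is definitionally 𝟙 (x ≟ y ×-dec xs ≟ ys).
𝟙 : ∀ {P : Set} → Dec P → ℕ
𝟙 p = if does p then 1 else 0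

module _ {P Q : Set} where

  𝟙-cong : P ⇔ Q → (p : Dec P) (q : Dec Q) → 𝟙 p ≡ 𝟙 q
  𝟙-cong P⇔Q p q = cong (λ b → if b then 1 else 0) (does-⇔ P⇔Q p q)

  𝟙-× : (p : Dec P) (q : Dec Q) → 𝟙 (p ×-dec q) ≡ 𝟙 p * 𝟙 q
  𝟙-× (yes _) (yes _) = refl
  𝟙-× (yes _) (no _)  = refl
  𝟙-× (no _)  _       = refl

module _ {P : Set} where

  𝟙-yes : (p : Dec P) → P → 𝟙 p ≡ 1
  𝟙-yes (yes _) _ = refl
  𝟙-yes (no ¬p) p = ⊥-elim (¬p p)

  𝟙-no : (p : Dec P) → ¬ P → 𝟙 p ≡ 0
  𝟙-no (yes p) ¬p = ⊥-elim (¬p p)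
  𝟙-no (no _)  _  = refl

  𝟙*-congˡ : (p : Dec P) {a b : ℕ} → (P → a ≡ b) → 𝟙 p * a ≡ 𝟙 p * b
  𝟙*-congˡ (yes p) a≡b = cong (_+ 0) (a≡b p)
  𝟙*-congˡ (no _)  _   = refl

  does≡true⇒ : (p : Dec P) → does p ≡ true → P
  does≡true⇒ (yes p) _ = p

∑ : ∀ {A : Set} → List A → (A → ℕ) → ℕ
∑ xs h = sum (map h xs)

module _ {A : Set} where

  ∑-cong : ∀ {h h' : A → ℕ} → (∀ x → h x ≡ h' x) → ∀ xs → ∑ xs h ≡ ∑ xs h'
  ∑-cong h≗h' xs = cong sum (List.map-cong h≗h' xs)

  ∑-cong-All : ∀ {h h' : A → ℕ} {xs} → All (λ x → h x ≡ h' x) xs → ∑ xs h ≡ ∑ xs h'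
  ∑-cong-All eqs = cong sum (List.map-cong-local eqs)

  ∑-++ : ∀ xs ys (h : A → ℕ) → ∑ (xs ++ ys) h ≡ ∑ xs h + ∑ ys h
  ∑-++ xs ys h = trans (cong sum (List.map-++ h xs ys)) (sum-++ (map h xs) (map h ys))

  ∑-0 : ∀ xs {h : A → ℕ} → (∀ x → h x ≡ 0) → ∑ xs h ≡ 0
  ∑-0 []       h≡0 = refl
  ∑-0 (x ∷ xs) h≡0 = cong₂ _+_ (h≡0 x) (∑-0 xs h≡0)

  ∑-+ : ∀ xs (h k : A → ℕ) → ∑ xs (λ x → h x + k x) ≡ ∑ xs h + ∑ xs k
  ∑-+ []       h k = refl
  ∑-+ (x ∷ xs) h k = begin
    (h x + k x) + ∑ xs (λ x → h x + k x) ≡⟨ cong (h x + k x +_) (∑-+ xs h k) ⟩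
    (h x + k x) + (∑ xs h + ∑ xs k)      ≡⟨ interchange (h x) (k x) (∑ xs h) (∑ xs k) ⟩
    (h x + ∑ xs h) + (k x + ∑ xs k)      ∎
    where open ≡-Reasoning

  ∑-*ˡ : ∀ xs c (h : A → ℕ) → ∑ xs (λ x → c * h x) ≡ c * ∑ xs h
  ∑-*ˡ []       c h = sym (ℕ.*-zeroʳ c)
  ∑-*ˡ (x ∷ xs) c h = trans (cong (c * h x +_) (∑-*ˡ xs c h)) (sym (ℕ.*-distribˡ-+ c (h x) (∑ xs h)))

  ∑-*ʳ : ∀ xs c (h : A → ℕ) → ∑ xs (λ x → h x * c) ≡ ∑ xs h * c
  ∑-*ʳ []       c h = refl
  ∑-*ʳ (x ∷ xs) c h = trans (cong (h x * c +_) (∑-*ʳ xs c h)) (sym (ℕ.*-distribʳ-+ c (h x) (∑ xs h)))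

  ∑-filter : ∀ {P : A → Set} (P? : ∀ x → Dec (P x)) xs (h : A → ℕ) →
             ∑ (filter P? xs) h ≡ ∑ xs (λ x → 𝟙 (P? x) * h x)
  ∑-filter P? []       h = refl
  ∑-filter P? (x ∷ xs) h with P? x
  ... | yes _ = cong₂ _+_ (sym (ℕ.+-identityʳ (h x))) (∑-filter P? xs h)
  ... | no _  = ∑-filter P? xs h

  count≡∑𝟙 : ∀ {P : A → Set} (P? : ∀ x → Dec (P x)) xs → count P? xs ≡ ∑ xs (𝟙 ∘ P?)
  count≡∑𝟙 P? []       = refl
  count≡∑𝟙 P? (x ∷ xs) with P? x
  ... | yes _ = cong suc (count≡∑𝟙 P? xs)
  ... | no _  = count≡∑𝟙 P? xs

  count≢0⇒∃ : ∀ {P : A → Set} (P? : ∀ x → Dec (P x)) xs → ¬ count P? xs ≡ 0 → ∃ P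
  count≢0⇒∃ P? []       count≢0 = ⊥-elim (count≢0 refl)
  count≢0⇒∃ P? (x ∷ xs) count≢0 with P? x
  ... | yes px = x , px
  ... | no _   = count≢0⇒∃ P? xs count≢0

  occurrences : DecidableEquality A → A → List A → ℕ
  occurrences _≟_ a xs = ∑ xs (λ b → 𝟙 (a ≟ b))

  ∑-sift : ∀ (_≟_ : DecidableEquality A) (a : A) xs (h : A → ℕ) →
           ∑ xs (λ b → 𝟙 (a ≟ b) * h b) ≡ occurrences _≟_ a xs * h a
  ∑-sift _≟_ a xs h = trans (∑-cong at-a xs) (∑-*ʳ xs (h a) (λ b → 𝟙 (a ≟ b)))
    where
    at-a : ∀ b → 𝟙 (a ≟ b) * h b ≡ 𝟙 (a ≟ b) * h a
    at-a b with a ≟ b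
    ... | yes refl = refl
    ... | no _     = refl

  count-cong : ∀ {P Q : A → Set} (P? : ∀ x → Dec (P x)) (Q? : ∀ x → Dec (Q x)) →
               (∀ x → P x ⇔ Q x) → ∀ xs → count P? xs ≡ count Q? xs
  count-cong P? Q? P⇔Q xs = begin
    count P? xs      ≡⟨ count≡∑𝟙 P? xs ⟩
    ∑ xs (𝟙 ∘ P?)    ≡⟨ ∑-cong (λ x → 𝟙-cong (P⇔Q x) (P? x) (Q? x)) xs ⟩
    ∑ xs (𝟙 ∘ Q?)    ≡⟨ count≡∑𝟙 Q? xs ⟨
    count Q? xs      ∎
    where open ≡-Reasoning

  𝟙-≟-sym : ∀ (_≟_ : DecidableEquality A) a b → 𝟙 (a ≟ b) ≡ 𝟙 (b ≟ a)
  𝟙-≟-sym _≟_ a b = 𝟙-cong (mk⇔ sym sym) (a ≟ b) (b ≟ a)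

  occurrences-filter : ∀ (_≟_ : DecidableEquality A) {P : A → Set} (P? : ∀ x → Dec (P x)) a xs →
                       occurrences _≟_ a (filter P? xs) ≡ 𝟙 (P? a) * occurrences _≟_ a xs
  occurrences-filter _≟_ P? a xs = begin
    occurrences _≟_ a (filter P? xs)      ≡⟨ ∑-filter P? xs (λ b → 𝟙 (a ≟ b)) ⟩
    ∑ xs (λ b → 𝟙 (P? b) * 𝟙 (a ≟ b))     ≡⟨ ∑-cong at-a xs ⟩
    ∑ xs (λ b → 𝟙 (P? a) * 𝟙 (a ≟ b))     ≡⟨ ∑-*ˡ xs (𝟙 (P? a)) (λ b → 𝟙 (a ≟ b)) ⟩
    𝟙 (P? a) * occurrences _≟_ a xs       ∎
    where
    open ≡-Reasoning
    at-a : ∀ b → 𝟙 (P? b) * 𝟙 (a ≟ b) ≡ 𝟙 (P? a) * 𝟙 (a ≟ b)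
    at-a b with a ≟ b
    ... | yes refl = refl
    ... | no _     = trans (ℕ.*-zeroʳ (𝟙 (P? b))) (sym (ℕ.*-zeroʳ (𝟙 (P? a))))

module _ {A B : Set} where

  ∑-map : ∀ (f : A → B) xs (h : B → ℕ) → ∑ (map f xs) h ≡ ∑ xs (h ∘ f)
  ∑-map f xs h = cong sum (sym (List.map-∘ xs))

  ∑-concatMap : ∀ (f : A → List B) xs (h : B → ℕ) → ∑ (concatMap f xs) h ≡ ∑ xs (λ x → ∑ (f x) h)
  ∑-concatMap f []       h = refl
  ∑-concatMap f (x ∷ xs) h = trans (∑-++ (f x) (concatMap f xs) h) (cong (∑ (f x) h +_) (∑-concatMap f xs h))

  ∑-swap : ∀ xs ys (h : A → B → ℕ) → ∑ xs (λ x → ∑ ys (h x)) ≡ ∑ ys (λ y → ∑ xs (λ x → h x y))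
  ∑-swap []       ys h = sym (∑-0 ys (λ _ → refl))
  ∑-swap (x ∷ xs) ys h = trans (cong (∑ ys (h x) +_) (∑-swap xs ys h)) (sym (∑-+ ys (h x) _))

  ∑∑-* : ∀ as bs (h : A → ℕ) (k : B → ℕ) → ∑ bs (λ b → ∑ as (λ a → h a * k b)) ≡ ∑ as h * ∑ bs k
  ∑∑-* as bs h k = begin
    ∑ bs (λ b → ∑ as (λ a → h a * k b))   ≡⟨ ∑-cong (λ b → ∑-*ʳ as (k b) h) bs ⟩
    ∑ bs (λ b → ∑ as h * k b)             ≡⟨ ∑-*ˡ bs (∑ as h) k ⟩
    ∑ as h * ∑ bs k                       ∎
    where open ≡-Reasoning

module _ {A B C : Set} where

  ∑-pairs : ∀ (f : A → B → C) as bs (h : C → ℕ) →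
            ∑ (concatMap (λ b → map (λ a → f a b) as) bs) h ≡ ∑ bs (λ b → ∑ as (λ a → h (f a b)))
  ∑-pairs f as bs h = trans (∑-concatMap _ bs h) (∑-cong (λ b → ∑-map (λ a → f a b) as h) bs)

_≟ˢ_ : ∀ {n} → DecidableEquality (Subset n)
_≟ˢ_ = Vec.≡-dec Bool._≟_

_≟ᵛ_ : ∀ {n k} → DecidableEquality (Vec (Subset n) k)
_≟ᵛ_ = Vec.≡-dec _≟ˢ_

_≟ˡ_ : DecidableEquality (List ℕ)
_≟ˡ_ = List.≡-dec ℕ._≟_

occurrences-allSubsets : ∀ n (s : Subset n) → occurrences _≟ˢ_ s (allSubsets n) ≡ 1
occurrences-allSubsets zero    []      = refl
occurrences-allSubsets (suc n) (b ∷ s) = begin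
  occurrences _≟ˢ_ (b ∷ s) (allSubsets (suc n))
    ≡⟨ ∑-concatMap _ (allSubsets n) _ ⟩
  ∑ (allSubsets n) (λ t → 𝟙 ((b ∷ s) ≟ˢ (false ∷ t)) + (𝟙 ((b ∷ s) ≟ˢ (true ∷ t)) + 0))
    ≡⟨ ∑-cong (one-head b) (allSubsets n) ⟩
  occurrences _≟ˢ_ s (allSubsets n)
    ≡⟨ occurrences-allSubsets n s ⟩
  1 ∎
  where
  open ≡-Reasoning
  one-head : ∀ b t → 𝟙 ((b ∷ s) ≟ˢ (false ∷ t)) + (𝟙 ((b ∷ s) ≟ˢ (true ∷ t)) + 0) ≡ 𝟙 (s ≟ˢ t)
  one-head false t = ℕ.+-identityʳ _
  one-head true  t = ℕ.+-identityʳ _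

occurrences-allSubsetVecs : ∀ n k (W : Vec (Subset n) k) → occurrences _≟ᵛ_ W (allSubsetVecs n k) ≡ 1
occurrences-allSubsetVecs n zero    []      = refl
occurrences-allSubsetVecs n (suc k) (s ∷ W) = begin
  occurrences _≟ᵛ_ (s ∷ W) (allSubsetVecs n (suc k))
    ≡⟨ ∑-pairs _∷_ (allSubsets n) (allSubsetVecs n k) _ ⟩
  ∑ (allSubsetVecs n k) (λ B → ∑ (allSubsets n) (λ t → 𝟙 (s ≟ˢ t ×-dec W ≟ᵛ B)))
    ≡⟨ ∑-cong (λ B → ∑-cong (λ t → 𝟙-× (s ≟ˢ t) (W ≟ᵛ B)) (allSubsets n)) (allSubsetVecs n k) ⟩
  ∑ (allSubsetVecs n k) (λ B → ∑ (allSubsets n) (λ t → 𝟙 (s ≟ˢ t) * 𝟙 (W ≟ᵛ B)))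
    ≡⟨ ∑∑-* (allSubsets n) (allSubsetVecs n k) _ _ ⟩
  occurrences _≟ˢ_ s (allSubsets n) * occurrences _≟ᵛ_ W (allSubsetVecs n k)
    ≡⟨ cong₂ _*_ (occurrences-allSubsets n s) (occurrences-allSubsetVecs n k W) ⟩
  1 ∎
  where open ≡-Reasoning

allFin-suc : ∀ x → allFin (suc x) ≡ Fin.zero ∷ map Fin.suc (allFin x)
allFin-suc x = cong (Fin.zero ∷_) (sym (List.map-tabulate (λ i → i) Fin.suc))

occurrences-allFin : ∀ x (a : Fin x) → occurrences Fin._≟_ a (allFin x) ≡ 1
occurrences-allFin (suc x) a = begin
  occurrences Fin._≟_ a (allFin (suc x))
    ≡⟨ cong (occurrences Fin._≟_ a) (allFin-suc x) ⟩
  𝟙 (a Fin.≟ Fin.zero) + ∑ (map Fin.suc (allFin x)) (λ b → 𝟙 (a Fin.≟ b))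
    ≡⟨ cong (𝟙 (a Fin.≟ Fin.zero) +_) (∑-map Fin.suc (allFin x) _) ⟩
  𝟙 (a Fin.≟ Fin.zero) + ∑ (allFin x) (λ b → 𝟙 (a Fin.≟ Fin.suc b))
    ≡⟨ split a ⟩
  1 ∎
  where
  open ≡-Reasoning
  split : ∀ a → 𝟙 (a Fin.≟ Fin.zero) + ∑ (allFin x) (λ b → 𝟙 (a Fin.≟ Fin.suc b)) ≡ 1
  split Fin.zero    = cong suc (∑-0 (allFin x) (λ _ → refl))
  split (Fin.suc a) = occurrences-allFin x a

upTo-suc : ∀ N → upTo (suc N) ≡ 0 ∷ map suc (upTo N)
upTo-suc N = cong (0 ∷_) (sym (List.map-upTo suc N))

∑-upTo-suc : ∀ N (h : ℕ → ℕ) → ∑ (upTo (suc N)) h ≡ h 0 + ∑ (upTo N) (h ∘ suc)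
∑-upTo-suc N h = trans (cong (λ l → ∑ l h) (upTo-suc N)) (cong (h 0 +_) (∑-map suc (upTo N) h))

occurrences-upTo : ∀ N c → occurrences ℕ._≟_ c (upTo N) ≡ 𝟙 (c ℕ.<? N)
occurrences-upTo zero    c       = refl
occurrences-upTo (suc N) zero    = trans (∑-upTo-suc N (λ i → 𝟙 (0 ℕ.≟ i))) (cong suc (∑-0 (upTo N) (λ _ → refl)))
occurrences-upTo (suc N) (suc c) = trans (∑-upTo-suc N (λ i → 𝟙 (suc c ℕ.≟ i))) (occurrences-upTo N c)

IsBoundedList : ℕ → ℕ → List ℕ → Set
IsBoundedList k b β = length β ≡ k × All (_≤ b) β

isBoundedList? : ∀ k b β → Dec (IsBoundedList k b β)
isBoundedList? k b β = (length β ℕ.≟ k) ×-dec All.all? (ℕ._≤? b) β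

occurrences-allLists : ∀ k b β → occurrences _≟ˡ_ β (allLists k b) ≡ 𝟙 (isBoundedList? k b β)
occurrences-allLists zero    b []      = refl
occurrences-allLists zero    b (c ∷ β) = refl
occurrences-allLists (suc k) b []      =
  trans (∑-pairs _∷_ (upTo (suc b)) (allLists k b) _) (∑-0 (allLists k b) (λ l → ∑-0 (upTo (suc b)) (λ a → refl)))
occurrences-allLists (suc k) b (c ∷ β) = begin
  occurrences _≟ˡ_ (c ∷ β) (allLists (suc k) b)
    ≡⟨ ∑-pairs _∷_ (upTo (suc b)) (allLists k b) _ ⟩
  ∑ (allLists k b) (λ l → ∑ (upTo (suc b)) (λ a → 𝟙 (c ℕ.≟ a ×-dec β ≟ˡ l)))
    ≡⟨ ∑-cong (λ l → ∑-cong (λ a → 𝟙-× (c ℕ.≟ a) (β ≟ˡ l)) (upTo (suc b))) (allLists k b) ⟩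
  ∑ (allLists k b) (λ l → ∑ (upTo (suc b)) (λ a → 𝟙 (c ℕ.≟ a) * 𝟙 (β ≟ˡ l)))
    ≡⟨ ∑∑-* (upTo (suc b)) (allLists k b) (λ a → 𝟙 (c ℕ.≟ a)) (λ l → 𝟙 (β ≟ˡ l)) ⟩
  occurrences ℕ._≟_ c (upTo (suc b)) * occurrences _≟ˡ_ β (allLists k b)
    ≡⟨ cong₂ _*_ (occurrences-upTo (suc b) c) (occurrences-allLists k b β) ⟩
  𝟙 (c ℕ.<? suc b) * 𝟙 (isBoundedList? k b β)
    ≡⟨ sym (𝟙-× (c ℕ.<? suc b) (isBoundedList? k b β)) ⟩
  𝟙 (c ℕ.<? suc b ×-dec isBoundedList? k b β)
    ≡⟨ 𝟙-cong (mk⇔ (λ { (c<1+b , ∣β∣≡k , β≤b) → cong suc ∣β∣≡k , s≤s⁻¹ c<1+b ∷ β≤b })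
                   (λ { (∣cβ∣≡1+k , c≤b ∷ β≤b) → s≤s c≤b , ℕ.suc-injective ∣cβ∣≡1+k , β≤b }))
              (c ℕ.<? suc b ×-dec isBoundedList? k b β) (isBoundedList? (suc k) b (c ∷ β)) ⟩
  𝟙 (isBoundedList? (suc k) b (c ∷ β)) ∎
  where open ≡-Reasoning

length≤sum : ∀ β → All (0 <_) β → length β ≤ sum β
length≤sum []      []             = z≤n
length≤sum (c ∷ β) (0<c ∷ 0<β)    = ℕ.+-mono-≤ 0<c (length≤sum β 0<β)

All≤sum : ∀ β → All (_≤ sum β) β
All≤sum []      = []
All≤sum (c ∷ β) = ℕ.m≤m+n c (sum β) ∷ All.map (λ a≤ → ℕ.≤-trans a≤ (ℕ.m≤n+m (sum β) c)) (All≤sum β)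

occurrences-compositions : ∀ m β → occurrences _≟ˡ_ β (compositions m) ≡ 𝟙 (isComposition? m β)
occurrences-compositions m β = begin
  occurrences _≟ˡ_ β (compositions m)
    ≡⟨ occurrences-filter _≟ˡ_ (isComposition? m) β candidates ⟩
  𝟙 (isComposition? m β) * occurrences _≟ˡ_ β candidates
    ≡⟨ 𝟙*-congˡ (isComposition? m β) occurrences-candidates ⟩
  𝟙 (isComposition? m β) * 1
    ≡⟨ ℕ.*-identityʳ _ ⟩
  𝟙 (isComposition? m β) ∎
  where
  open ≡-Reasoning
  candidates : List (List ℕ)
  candidates = concatMap (λ k → allLists k m) (upTo (suc m))
  occurrences-candidates : IsComposition m β → occurrences _≟ˡ_ β candidates ≡ 1
  occurrences-candidates (0<β , Σβ≡m) = begin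
    occurrences _≟ˡ_ β candidates
      ≡⟨ ∑-concatMap (λ k → allLists k m) (upTo (suc m)) (λ α → 𝟙 (β ≟ˡ α)) ⟩
    ∑ (upTo (suc m)) (λ k → occurrences _≟ˡ_ β (allLists k m))
      ≡⟨ ∑-cong (λ k → trans (occurrences-allLists k m β)
                             (𝟙-cong (mk⇔ proj₁ (_, β≤m)) (isBoundedList? k m β) (length β ℕ.≟ k)))
                (upTo (suc m)) ⟩
    occurrences ℕ._≟_ (length β) (upTo (suc m))
      ≡⟨ occurrences-upTo (suc m) (length β) ⟩
    𝟙 (length β ℕ.<? suc m)
      ≡⟨ 𝟙-yes (length β ℕ.<? suc m) (s≤s (subst (length β ≤_) Σβ≡m (length≤sum β 0<β))) ⟩
    1 ∎
    where
    β≤m : All (_≤ m) β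
    β≤m = subst (λ s → All (_≤ s) β) Σβ≡m (All≤sum β)

allLists-length : ∀ k b → All (λ m → length m ≡ k) (allLists k b)
allLists-length zero    b = refl ∷ []
allLists-length (suc k) b =
  All.concat⁺ (All.map⁺ (All.map (λ ∣l∣≡k → All.map⁺ (All.universal (λ _ → cong suc ∣l∣≡k) _)) (allLists-length k b)))

nonzeroExps-positive : ∀ m → All (0 <_) (nonzeroExps m)
nonzeroExps-positive []          = []
nonzeroExps-positive (zero ∷ m)  = nonzeroExps-positive m
nonzeroExps-positive (suc a ∷ m) = s≤s z≤n ∷ nonzeroExps-positive m

M≡𝟙 : ∀ α m → M α m ≡ 𝟙 (nonzeroExps m ≟ˡ α)
M≡𝟙 α m with nonzeroExps m ≟ˡ α
... | yes _ = refl
... | no _  = refl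

-- M_β evaluated at x ones; exponents above b do not occur in M_β.
∑-M-allLists : ∀ x b β → All (0 <_) β → All (_≤ b) β → ∑ (allLists x b) (M β) ≡ x C length β
∑-M-allLists x b β 0<β β≤b = trans (∑-cong (M≡𝟙 β) (allLists x b)) (of-type x β 0<β β≤b)
  where
  first-zero-or-not : ∀ x β →
    ∑ (allLists (suc x) b) (λ m → 𝟙 (nonzeroExps m ≟ˡ β))
    ≡ ∑ (allLists x b) (λ l → 𝟙 (nonzeroExps l ≟ˡ β))
      + ∑ (allLists x b) (λ l → ∑ (upTo b) (λ i → 𝟙 ((suc i ∷ nonzeroExps l) ≟ˡ β)))
  first-zero-or-not x β = begin
    ∑ (allLists (suc x) b) (λ m → 𝟙 (nonzeroExps m ≟ˡ β))
      ≡⟨ ∑-pairs _∷_ (upTo (suc b)) (allLists x b) (λ m → 𝟙 (nonzeroExps m ≟ˡ β)) ⟩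
    ∑ (allLists x b) (λ l → ∑ (upTo (suc b)) (λ a → 𝟙 (nonzeroExps (a ∷ l) ≟ˡ β)))
      ≡⟨ ∑-cong (λ l → ∑-upTo-suc b (λ a → 𝟙 (nonzeroExps (a ∷ l) ≟ˡ β))) (allLists x b) ⟩
    ∑ (allLists x b) (λ l → 𝟙 (nonzeroExps l ≟ˡ β) + ∑ (upTo b) (λ i → 𝟙 ((suc i ∷ nonzeroExps l) ≟ˡ β)))
      ≡⟨ ∑-+ (allLists x b) (λ l → 𝟙 (nonzeroExps l ≟ˡ β)) _ ⟩
    _ ∎
    where open ≡-Reasoning

  first-positive : ∀ x c β → c < b →
    ∑ (allLists x b) (λ l → ∑ (upTo b) (λ i → 𝟙 ((suc i ∷ nonzeroExps l) ≟ˡ (suc c ∷ β))))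
    ≡ ∑ (allLists x b) (λ l → 𝟙 (nonzeroExps l ≟ˡ β))
  first-positive x c β c<b = begin
    ∑ (allLists x b) (λ l → ∑ (upTo b) (λ i → 𝟙 (i ℕ.≟ c ×-dec nonzeroExps l ≟ˡ β)))
      ≡⟨ ∑-cong (λ l → ∑-cong (λ i → 𝟙-× (i ℕ.≟ c) (nonzeroExps l ≟ˡ β)) (upTo b)) (allLists x b) ⟩
    ∑ (allLists x b) (λ l → ∑ (upTo b) (λ i → 𝟙 (i ℕ.≟ c) * 𝟙 (nonzeroExps l ≟ˡ β)))
      ≡⟨ ∑∑-* (upTo b) (allLists x b) (λ i → 𝟙 (i ℕ.≟ c)) (λ l → 𝟙 (nonzeroExps l ≟ˡ β)) ⟩
    ∑ (upTo b) (λ i → 𝟙 (i ℕ.≟ c)) * ∑ (allLists x b) (λ l → 𝟙 (nonzeroExps l ≟ˡ β))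
      ≡⟨ cong (_* ∑ (allLists x b) (λ l → 𝟙 (nonzeroExps l ≟ˡ β))) c-once ⟩
    1 * ∑ (allLists x b) (λ l → 𝟙 (nonzeroExps l ≟ˡ β))
      ≡⟨ ℕ.*-identityˡ _ ⟩
    ∑ (allLists x b) (λ l → 𝟙 (nonzeroExps l ≟ˡ β)) ∎
    where
    open ≡-Reasoning
    c-once : ∑ (upTo b) (λ i → 𝟙 (i ℕ.≟ c)) ≡ 1
    c-once = begin
      ∑ (upTo b) (λ i → 𝟙 (i ℕ.≟ c))  ≡⟨ ∑-cong (λ i → 𝟙-≟-sym ℕ._≟_ i c) (upTo b) ⟩
      occurrences ℕ._≟_ c (upTo b)    ≡⟨ occurrences-upTo b c ⟩
      𝟙 (c ℕ.<? b)                    ≡⟨ 𝟙-yes (c ℕ.<? b) c<b ⟩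
      1                               ∎

  of-type : ∀ x β → All (0 <_) β → All (_≤ b) β →
            ∑ (allLists x b) (λ m → 𝟙 (nonzeroExps m ≟ˡ β)) ≡ x C length β
  of-type zero    []          _         _           = refl
  of-type zero    (_ ∷ _)     _         _           = refl
  of-type (suc x) []          _         _           =
    trans (first-zero-or-not x [])
          (cong₂ _+_ (of-type x [] [] []) (∑-0 (allLists x b) (λ _ → ∑-0 (upTo b) (λ _ → refl))))
  of-type (suc x) (zero ∷ β)  (() ∷ _)  _
  of-type (suc x) (suc c ∷ β) (_ ∷ 0<β) (c<b ∷ β≤b) = begin
    ∑ (allLists (suc x) b) (λ m → 𝟙 (nonzeroExps m ≟ˡ (suc c ∷ β)))
      ≡⟨ first-zero-or-not x (suc c ∷ β) ⟩
    _ ≡⟨ cong₂ _+_ (of-type x (suc c ∷ β) (s≤s z≤n ∷ 0<β) (c<b ∷ β≤b))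
                   (trans (first-positive x c β c<b) (of-type x β 0<β β≤b)) ⟩
    x C suc (length β) + x C length β  ≡⟨ ℕ.+-comm (x C suc (length β)) (x C length β) ⟩
    x C length β + x C suc (length β)  ≡⟨ nCk+nC[k+1]≡[n+1]C[k+1] x (length β) ⟩
    suc x C suc (length β)             ∎
    where open ≡-Reasoning

-- Maps and weak set compositions

module _ {x : ℕ} where

  ExactlyOne : (Fin x → Bool) → Set
  ExactlyOne h = (∃ λ i → h i ≡ true) × (∀ i j → h i ≡ true → h j ≡ true → i ≡ j)

  exactlyOne? : ∀ h → Dec (ExactlyOne h)
  exactlyOne? h = any? (λ i → h i Bool.≟ true)
            ×-dec all? (λ i → all? λ j → (h i Bool.≟ true) →-dec ((h j Bool.≟ true) →-dec (i Fin.≟ j)))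

  ExactlyOne-cong : ∀ {h h' : Fin x → Bool} → (∀ i → h i ≡ h' i) → ExactlyOne h → ExactlyOne h'
  ExactlyOne-cong h≗h' ((i , hi) , unique) =
    (i , trans (sym (h≗h' i)) hi) , λ i j h'i h'j → unique i j (trans (h≗h' i) h'i) (trans (h≗h' j) h'j)

  indicator : Fin x → Subset x
  indicator a = tabulate (λ i → does (a Fin.≟ i))

  indicator-exactlyOne : ∀ a → ExactlyOne (lookup (indicator a))
  indicator-exactlyOne a = (a , at a (dec-true (a Fin.≟ a) refl)) , λ i j a∈i a∈j →
    trans (sym (does≡true⇒ (a Fin.≟ i) (at⁻ i a∈i))) (does≡true⇒ (a Fin.≟ j) (at⁻ j a∈j))
    where
    at : ∀ i → does (a Fin.≟ i) ≡ true → lookup (indicator a) i ≡ true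
    at i = trans (Vec.lookup∘tabulate _ i)
    at⁻ : ∀ i → lookup (indicator a) i ≡ true → does (a Fin.≟ i) ≡ true
    at⁻ i = trans (sym (Vec.lookup∘tabulate _ i))

  count-indicator : ∀ (c : Subset x) → ∑ (allFin x) (λ a → 𝟙 (indicator a ≟ˢ c)) ≡ 𝟙 (exactlyOne? (lookup c))
  count-indicator c = by-cases (exactlyOne? (lookup c))
    where
    by-cases : (one? : Dec (ExactlyOne (lookup c))) → ∑ (allFin x) (λ a → 𝟙 (indicator a ≟ˢ c)) ≡ 𝟙 one?
    by-cases (no ¬one) = ∑-0 (allFin x) λ a →
      𝟙-no (indicator a ≟ˢ c) (λ a≡c → ¬one (subst (ExactlyOne ∘ lookup) a≡c (indicator-exactlyOne a)))
    by-cases (yes ((i₀ , c[i₀]) , unique)) = begin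
      ∑ (allFin x) (λ a → 𝟙 (indicator a ≟ˢ c))
        ≡⟨ ∑-cong (λ a → 𝟙-cong (mk⇔ (i₀≡ a) (≡c a)) (indicator a ≟ˢ c) (i₀ Fin.≟ a)) (allFin x) ⟩
      occurrences Fin._≟_ i₀ (allFin x)
        ≡⟨ occurrences-allFin x i₀ ⟩
      1 ∎
      where
      open ≡-Reasoning
      i₀≡ : ∀ a → indicator a ≡ c → i₀ ≡ a
      i₀≡ a a≡c = sym (does≡true⇒ (a Fin.≟ i₀)
        (trans (sym (Vec.lookup∘tabulate _ i₀)) (trans (cong (λ z → lookup z i₀) a≡c) c[i₀])))
      ≡c : ∀ a → i₀ ≡ a → indicator a ≡ c
      ≡c a refl = trans (Vec.tabulate-cong at) (Vec.tabulate∘lookup c)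
        where
        at : ∀ i → does (i₀ Fin.≟ i) ≡ lookup c i
        at i with i₀ Fin.≟ i
        ... | yes refl = sym c[i₀]
        ... | no i₀≢i with lookup c i in c[i]
        ...   | true  = ⊥-elim (i₀≢i (unique i₀ i c[i₀] c[i]))
        ...   | false = refl

module _ {A : Set} {m : ℕ} where

  heads : ∀ {x} → Vec (Vec A (suc m)) x → Vec A x
  heads = Vec.map Vec.head

  tails : ∀ {x} → Vec (Vec A (suc m)) x → Vec (Vec A m) x
  tails = Vec.map Vec.tail

  tabulate-∷-≡ : ∀ {x} (h : Fin x → A) (t : Fin x → Vec A m) (W : Vec (Vec A (suc m)) x) →
                 tabulate (λ i → h i ∷ t i) ≡ W ⇔ (tabulate h ≡ heads W × tabulate t ≡ tails W)
  tabulate-∷-≡ h t W = mk⇔ (λ { refl → Vec.tabulate-∘ Vec.head _ , Vec.tabulate-∘ Vec.tail _ })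
                           (λ (h≡ , t≡) → from h t W h≡ t≡)
    where
    from : ∀ {x} (h : Fin x → A) (t : Fin x → Vec A m) (W : Vec (Vec A (suc m)) x) →
           tabulate h ≡ heads W → tabulate t ≡ tails W → tabulate (λ i → h i ∷ t i) ≡ W
    from h t []             _  _  = refl
    from h t ((c ∷ s) ∷ W) h≡ t≡ =
      cong₂ _∷_ (cong₂ _∷_ (Vec.∷-injectiveˡ h≡) (Vec.∷-injectiveˡ t≡))
                (from (h ∘ Fin.suc) (t ∘ Fin.suc) W (Vec.∷-injectiveʳ h≡) (Vec.∷-injectiveʳ t≡))

  lookup-heads : ∀ {x} (W : Vec (Vec A (suc m)) x) i → lookup (heads W) i ≡ lookup (lookup W i) Fin.zero
  lookup-heads W i = trans (Vec.lookup-map i Vec.head W) (head≡ (lookup W i))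
    where head≡ : (s : Vec A (suc m)) → Vec.head s ≡ lookup s Fin.zero
          head≡ (_ ∷ _) = refl

  lookup-tails : ∀ {x} (W : Vec (Vec A (suc m)) x) i v →
                 lookup (lookup (tails W) i) v ≡ lookup (lookup W i) (Fin.suc v)
  lookup-tails W i v = trans (cong (λ s → lookup s v) (Vec.lookup-map i Vec.tail W)) (tail≡ (lookup W i))
    where tail≡ : (s : Vec A (suc m)) → lookup (Vec.tail s) v ≡ lookup s (Fin.suc v)
          tail≡ (_ ∷ _) = refl

toList-tabulate-≡ : ∀ {A : Set} (m : List A) (h : Fin (length m) → A) →
                    toList (tabulate h) ≡ m ⇔ (∀ i → h i ≡ List.lookup m i)
toList-tabulate-≡ m h = mk⇔ (to m h) (from m h)
  where
  to : ∀ m (h : Fin (length m) → _) → toList (tabulate h) ≡ m → ∀ i → h i ≡ List.lookup m i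
  to (c ∷ m) h eq Fin.zero    = List.∷-injectiveˡ eq
  to (c ∷ m) h eq (Fin.suc i) = to m (h ∘ Fin.suc) (List.∷-injectiveʳ eq) i
  from : ∀ m (h : Fin (length m) → _) → (∀ i → h i ≡ List.lookup m i) → toList (tabulate h) ≡ m
  from []      h _  = refl
  from (c ∷ m) h eq = cong₂ _∷_ (eq Fin.zero) (from m (h ∘ Fin.suc) (eq ∘ Fin.suc))

module _ {n x : ℕ} where

  IsWeakSetComposition : Vec (Subset n) x → Set
  IsWeakSetComposition W = ∀ v → ExactlyOne (λ i → lookup (lookup W i) v)

  isWeakSetComposition? : ∀ W → Dec (IsWeakSetComposition W)
  isWeakSetComposition? W = all? (λ v → exactlyOne? (λ i → lookup (lookup W i) v))

  fibres : (Fin n → Fin x) → Vec (Subset n) x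
  fibres f = tabulate (λ i → tabulate (λ v → does (f v Fin.≟ i)))

  lookup-fibres : ∀ (f : Fin n → Fin x) i v → lookup (lookup (fibres f) i) v ≡ does (f v Fin.≟ i)
  lookup-fibres f i v = trans (cong (λ s → lookup s v) (Vec.lookup∘tabulate _ i)) (Vec.lookup∘tabulate _ v)

  ∈-fibres⁺ : ∀ (f : Fin n → Fin x) {v i} → f v ≡ i → v ∈ lookup (fibres f) i
  ∈-fibres⁺ f {v} refl = Vec.lookup⇒[]= v _ (trans (lookup-fibres f (f v) v) (dec-true (f v Fin.≟ f v) refl))

  ∈-fibres⁻ : ∀ (f : Fin n → Fin x) {v i} → v ∈ lookup (fibres f) i → f v ≡ i
  ∈-fibres⁻ f {v} {i} v∈ = does≡true⇒ (f v Fin.≟ i) (trans (sym (lookup-fibres f i v)) (Vec.[]=⇒lookup v∈))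

fibres-≡ : ∀ {n x} (f f' : Fin n → Fin x) → fibres f ≡ fibres f' ⇔ (∀ v → f v ≡ f' v)
fibres-≡ f f' = mk⇔
  (λ eq v → sym (∈-fibres⁻ f' (subst (λ W → v ∈ lookup W (f v)) eq (∈-fibres⁺ f refl))))
  (λ f≗f' → Vec.tabulate-cong λ i → Vec.tabulate-cong λ v → cong (λ a → does (a Fin.≟ i)) (f≗f' v))

isWeakSetComposition-∷ : ∀ {n x} (W : Vec (Subset (suc n)) x) →
  IsWeakSetComposition W ⇔ (ExactlyOne (lookup (heads W)) × IsWeakSetComposition (tails W))
isWeakSetComposition-∷ W = mk⇔
  (λ wsc → ExactlyOne-cong (λ i → sym (lookup-heads W i)) (wsc Fin.zero)
         , λ v → ExactlyOne-cong (λ i → sym (lookup-tails W i v)) (wsc (Fin.suc v)))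
  (λ { (one , wsc) Fin.zero    → ExactlyOne-cong (lookup-heads W) one
     ; (one , wsc) (Fin.suc v) → ExactlyOne-cong (λ i → lookup-tails W i v) (wsc v) })

𝟙-fibres-∷ : ∀ {n x} (a : Fin x) (f : Fin n → Fin x) (W : Vec (Subset (suc n)) x) →
             𝟙 (fibres (a VF.∷ f) ≟ᵛ W) ≡ 𝟙 (indicator a ≟ˢ heads W) * 𝟙 (fibres f ≟ᵛ tails W)
𝟙-fibres-∷ a f W = trans
  (𝟙-cong (tabulate-∷-≡ (λ i → does (a Fin.≟ i)) (λ i → tabulate (λ v → does (f v Fin.≟ i))) W)
          (fibres (a VF.∷ f) ≟ᵛ W) (indicator a ≟ˢ heads W ×-dec fibres f ≟ᵛ tails W))
  (𝟙-× (indicator a ≟ˢ heads W) (fibres f ≟ᵛ tails W))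

count-fibres : ∀ n x (W : Vec (Subset n) x) →
               ∑ (allFuns n x) (λ f → 𝟙 (fibres f ≟ᵛ W)) ≡ 𝟙 (isWeakSetComposition? W)
count-fibres zero    x W = trans (cong (_+ 0) (𝟙-yes (fibres (λ ()) ≟ᵛ W) (no-points _ W)))
                                 (sym (𝟙-yes (isWeakSetComposition? W) (λ ())))
  where
  no-points : ∀ {x} (V W : Vec (Subset 0) x) → V ≡ W
  no-points []       []       = refl
  no-points ([] ∷ V) ([] ∷ W) = cong ([] ∷_) (no-points V W)
count-fibres (suc n) x W = begin
  ∑ (allFuns (suc n) x) (λ f → 𝟙 (fibres f ≟ᵛ W))
    ≡⟨ ∑-pairs VF._∷_ (allFin x) (allFuns n x) (λ f → 𝟙 (fibres f ≟ᵛ W)) ⟩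
  ∑ (allFuns n x) (λ f → ∑ (allFin x) (λ a → 𝟙 (fibres (a VF.∷ f) ≟ᵛ W)))
    ≡⟨ ∑-cong (λ f → ∑-cong (λ a → 𝟙-fibres-∷ a f W) (allFin x)) (allFuns n x) ⟩
  ∑ (allFuns n x) (λ f → ∑ (allFin x) (λ a → 𝟙 (indicator a ≟ˢ heads W) * 𝟙 (fibres f ≟ᵛ tails W)))
    ≡⟨ ∑∑-* (allFin x) (allFuns n x) _ _ ⟩
  ∑ (allFin x) (λ a → 𝟙 (indicator a ≟ˢ heads W)) * ∑ (allFuns n x) (λ f → 𝟙 (fibres f ≟ᵛ tails W))
    ≡⟨ cong₂ _*_ (count-indicator (heads W)) (count-fibres n x (tails W)) ⟩
  𝟙 (exactlyOne? (lookup (heads W))) * 𝟙 (isWeakSetComposition? (tails W))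
    ≡⟨ 𝟙-× (exactlyOne? (lookup (heads W))) (isWeakSetComposition? (tails W)) ⟨
  𝟙 (exactlyOne? (lookup (heads W)) ×-dec isWeakSetComposition? (tails W))
    ≡⟨ 𝟙-cong (isWeakSetComposition-∷ W) (isWeakSetComposition? W)
               (exactlyOne? (lookup (heads W)) ×-dec isWeakSetComposition? (tails W)) ⟨
  𝟙 (isWeakSetComposition? W) ∎
  where open ≡-Reasoning

count-via-fibres : ∀ n x {Q : Vec (Subset n) x → Set} (Q? : ∀ W → Dec (Q W)) →
                   (∀ W → Q W → IsWeakSetComposition W) →
                   count (Q? ∘ fibres) (allFuns n x) ≡ count Q? (allSubsetVecs n x)
count-via-fibres n x {Q} Q? Q⇒wsc = begin
  count (Q? ∘ fibres) (allFuns n x)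
    ≡⟨ count≡∑𝟙 (Q? ∘ fibres) (allFuns n x) ⟩
  ∑ (allFuns n x) (λ f → 𝟙 (Q? (fibres f)))
    ≡⟨ ∑-cong (λ f → sym (sifted f)) (allFuns n x) ⟩
  ∑ (allFuns n x) (λ f → ∑ (allSubsetVecs n x) (λ W → 𝟙 (fibres f ≟ᵛ W) * 𝟙 (Q? W)))
    ≡⟨ ∑-swap (allFuns n x) (allSubsetVecs n x) _ ⟩
  ∑ (allSubsetVecs n x) (λ W → ∑ (allFuns n x) (λ f → 𝟙 (fibres f ≟ᵛ W) * 𝟙 (Q? W)))
    ≡⟨ ∑-cong (λ W → ∑-*ʳ (allFuns n x) (𝟙 (Q? W)) _) (allSubsetVecs n x) ⟩
  ∑ (allSubsetVecs n x) (λ W → ∑ (allFuns n x) (λ f → 𝟙 (fibres f ≟ᵛ W)) * 𝟙 (Q? W))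
    ≡⟨ ∑-cong (λ W → cong (_* 𝟙 (Q? W)) (count-fibres n x W)) (allSubsetVecs n x) ⟩
  ∑ (allSubsetVecs n x) (λ W → 𝟙 (isWeakSetComposition? W) * 𝟙 (Q? W))
    ≡⟨ ∑-cong (λ W → drop-wsc W (Q? W)) (allSubsetVecs n x) ⟩
  ∑ (allSubsetVecs n x) (𝟙 ∘ Q?)
    ≡⟨ count≡∑𝟙 Q? (allSubsetVecs n x) ⟨
  count Q? (allSubsetVecs n x) ∎
  where
  open ≡-Reasoning
  sifted : ∀ f → ∑ (allSubsetVecs n x) (λ W → 𝟙 (fibres f ≟ᵛ W) * 𝟙 (Q? W)) ≡ 𝟙 (Q? (fibres f))
  sifted f = trans (∑-sift _≟ᵛ_ (fibres f) (allSubsetVecs n x) (𝟙 ∘ Q?))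
                   (trans (cong (_* 𝟙 (Q? (fibres f))) (occurrences-allSubsetVecs n x (fibres f))) (ℕ.*-identityˡ _))
  drop-wsc : ∀ W (q : Dec (Q W)) → 𝟙 (isWeakSetComposition? W) * 𝟙 q ≡ 𝟙 q
  drop-wsc W (yes q) = cong (_* 1) (𝟙-yes (isWeakSetComposition? W) (Q⇒wsc W q))
  drop-wsc W (no _)  = ℕ.*-zeroʳ (𝟙 (isWeakSetComposition? W))

disjoint-∷ : ∀ {k b c} {p q : Subset k} → (∀ v → v ∈ b ∷ p → v ∉ c ∷ q) → ∀ v → v ∈ p → v ∉ q
disjoint-∷ disjoint v v∈p v∈q = disjoint (Fin.suc v) (there v∈p) (there v∈q)

∣p∪q∣≡∣p∣+∣q∣ : ∀ {k} (p q : Subset k) → (∀ v → v ∈ p → v ∉ q) → ∣ p ∪ q ∣ ≡ ∣ p ∣ + ∣ q ∣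
∣p∪q∣≡∣p∣+∣q∣ []          []          _        = refl
∣p∪q∣≡∣p∣+∣q∣ (true  ∷ p) (true  ∷ q) disjoint = ⊥-elim (disjoint Fin.zero here here)
∣p∪q∣≡∣p∣+∣q∣ (true  ∷ p) (false ∷ q) disjoint = cong suc (∣p∪q∣≡∣p∣+∣q∣ p q (disjoint-∷ disjoint))
∣p∪q∣≡∣p∣+∣q∣ (false ∷ p) (true  ∷ q) disjoint =
  trans (cong suc (∣p∪q∣≡∣p∣+∣q∣ p q (disjoint-∷ disjoint))) (sym (ℕ.+-suc ∣ p ∣ ∣ q ∣))
∣p∪q∣≡∣p∣+∣q∣ (false ∷ p) (false ∷ q) disjoint = ∣p∪q∣≡∣p∣+∣q∣ p q (disjoint-∷ disjoint)

∣p∣≡n : ∀ {k} (p : Subset k) → (∀ v → v ∈ p) → ∣ p ∣ ≡ k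
∣p∣≡n {k} p all∈p = trans (cong ∣_∣ (⊆-antisym (λ _ → ∈⊤) (λ {v} _ → all∈p v))) (∣⊤∣≡n k)

nonempty⇒∣p∣>0 : ∀ {k} {p : Subset k} → Nonempty p → 0 < ∣ p ∣
nonempty⇒∣p∣>0 (v , v∈p) = ℕ.≤-<-trans z≤n (x∈p⇒∣p-x∣<∣p∣ v∈p)

∣p∣≡0⇒p≡⊥ : ∀ {k} {p : Subset k} → ∣ p ∣ ≡ 0 → p ≡ ⊥
∣p∣≡0⇒p≡⊥ ∣p∣≡0 = Empty-unique λ nonempty → ℕ.<⇒≢ (nonempty⇒∣p∣>0 nonempty) (sym ∣p∣≡0)

∣p∣>0⇒nonempty : ∀ {k} (p : Subset k) → 0 < ∣ p ∣ → Nonempty p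
∣p∣>0⇒nonempty {k} p ∣p∣>0 with nonempty? p
... | yes nonempty = nonempty
... | no empty = ⊥-elim (ℕ.<⇒≢ ∣p∣>0 (sym (trans (cong ∣_∣ (Empty-unique empty)) (∣⊥∣≡0 k))))

∈-⋃-take⁻ : ∀ {n k} (W : Vec (Subset n) k) t {v} →
            v ∈ ⋃ (take t (toList W)) → ∃ λ i → toℕ i < t × v ∈ lookup W i
∈-⋃-take⁻ []      zero    v∈ = ⊥-elim (∉⊥ v∈)
∈-⋃-take⁻ []      (suc t) v∈ = ⊥-elim (∉⊥ v∈)
∈-⋃-take⁻ (s ∷ W) zero    v∈ = ⊥-elim (∉⊥ v∈)
∈-⋃-take⁻ (s ∷ W) (suc t) v∈ with x∈p∪q⁻ s _ v∈
... | inj₁ v∈s = Fin.zero , s≤s z≤n , v∈s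
... | inj₂ v∈⋃ with i , i<t , v∈i ← ∈-⋃-take⁻ W t v∈⋃ = Fin.suc i , s≤s i<t , v∈i

∈-⋃-take⁺ : ∀ {n k} (W : Vec (Subset n) k) t {v} i → toℕ i < t → v ∈ lookup W i → v ∈ ⋃ (take t (toList W))
∈-⋃-take⁺ (s ∷ W) (suc t) Fin.zero    _         v∈s = x∈p∪q⁺ (inj₁ v∈s)
∈-⋃-take⁺ (s ∷ W) (suc t) (Fin.suc i) (s≤s i<t) v∈i = x∈p∪q⁺ (inj₂ (∈-⋃-take⁺ W t i i<t v∈i))

-- Weak D-set compositions

module _ {n : ℕ} (D : DoublePoset n) where

  -- W composes N ∖ U, with empty blocks allowed and the down-set condition
  -- on C₁ ∪ ⋯ ∪ C_p replaced by monotonicity of the block index along ≤₁;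
  -- U collects the blocks already placed.
  record IsWeakDComposition {x} (U : Subset n) (W : Vec (Subset n) x) : Set where
    field
      outside       : ∀ v a → v ∈ U → v ∉ lookup W a
      disjoint      : ∀ a b v → v ∈ lookup W a → v ∈ lookup W b → a ≡ b
      covers        : ∀ v → v ∈ U ⊎ ∃ λ a → v ∈ lookup W a
      downSet       : IsDownSet D U
      monotone      : ∀ i j a b → _≤₁_ D i j → i ∈ lookup W a → j ∈ lookup W b → a Fin.≤ b
      inversionFree : ∀ a i j → i ∈ lookup W a → j ∈ lookup W a → ¬ Inversion D i j

  open IsWeakDComposition

  isWeakDComposition? : ∀ {x} U (W : Vec (Subset n) x) → Dec (IsWeakDComposition U W)
  isWeakDComposition? U W = map′
    (λ (o , d , c , ds , m , i) → record { outside = o ; disjoint = d ; covers = c ; downSet = ds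
                                        ; monotone = m ; inversionFree = i })
    (λ w → outside w , disjoint w , covers w , downSet w , monotone w , inversionFree w)
    (      all? (λ v → all? λ a → (v ∈? U) →-dec ¬? (v ∈? lookup W a))
     ×-dec all? (λ a → all? λ b → all? λ v → (v ∈? lookup W a) →-dec ((v ∈? lookup W b) →-dec (a Fin.≟ b)))
     ×-dec all? (λ v → (v ∈? U) ⊎-dec any? (λ a → v ∈? lookup W a))
     ×-dec isDownSet? D U
     ×-dec all? (λ i → all? λ j → all? λ a → all? λ b →
             _≤₁?_ D i j →-dec ((i ∈? lookup W a) →-dec ((j ∈? lookup W b) →-dec (a Fin.≤? b))))
     ×-dec all? (λ a → all? λ i → all? λ j →
             (i ∈? lookup W a) →-dec ((j ∈? lookup W a) →-dec ¬? (inversion? D i j))))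

  IsNextBlock : Subset n → Subset n → Set
  IsNextBlock U s =
    (∀ v → v ∈ U → v ∉ s) × IsDownSet D (U ∪ s) × (∀ i j → i ∈ s → j ∈ s → ¬ Inversion D i j)

  isNextBlock? : ∀ U s → Dec (IsNextBlock U s)
  isNextBlock? U s = all? (λ v → (v ∈? U) →-dec ¬? (v ∈? s))
               ×-dec isDownSet? D (U ∪ s)
               ×-dec all? (λ i → all? λ j → (i ∈? s) →-dec ((j ∈? s) →-dec ¬? (inversion? D i j)))

  weak-∷⁻ : ∀ {x U s} {W : Vec (Subset n) x} →
            IsWeakDComposition U (s ∷ W) → IsNextBlock U s × IsWeakDComposition (U ∪ s) W
  weak-∷⁻ {U = U} {s} {W} weak =
    ((λ v v∈U → outside weak v Fin.zero v∈U) , downSet′ , inversionFree weak Fin.zero) ,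
    record
      { outside       = outside′
      ; disjoint      = λ a b v v∈a v∈b → Fin.suc-injective (disjoint weak (Fin.suc a) (Fin.suc b) v v∈a v∈b)
      ; covers        = covers′
      ; downSet       = downSet′
      ; monotone      = λ i j a b i≤j i∈a j∈b → s≤s⁻¹ (monotone weak i j (Fin.suc a) (Fin.suc b) i≤j i∈a j∈b)
      ; inversionFree = inversionFree weak ∘ Fin.suc
      }
    where
    downSet′ : IsDownSet D (U ∪ s)
    downSet′ v w w∈U∪s v≤w with x∈p∪q⁻ U s w∈U∪s
    ... | inj₁ w∈U = x∈p∪q⁺ (inj₁ (downSet weak v w w∈U v≤w))
    ... | inj₂ w∈s with covers weak v
    ...   | inj₁ v∈U                = x∈p∪q⁺ (inj₁ v∈U)
    ...   | inj₂ (Fin.zero , v∈s)   = x∈p∪q⁺ (inj₂ v∈s)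
    ...   | inj₂ (Fin.suc a , v∈a) with () ← monotone weak v w (Fin.suc a) Fin.zero v≤w v∈a w∈s
    outside′ : ∀ v a → v ∈ U ∪ s → v ∉ lookup W a
    outside′ v a v∈U∪s v∈a with x∈p∪q⁻ U s v∈U∪s
    ... | inj₁ v∈U = outside weak v (Fin.suc a) v∈U v∈a
    ... | inj₂ v∈s with () ← disjoint weak Fin.zero (Fin.suc a) v v∈s v∈a
    covers′ : ∀ v → v ∈ U ∪ s ⊎ ∃ λ a → v ∈ lookup W a
    covers′ v with covers weak v
    ... | inj₁ v∈U              = inj₁ (x∈p∪q⁺ (inj₁ v∈U))
    ... | inj₂ (Fin.zero , v∈s)  = inj₁ (x∈p∪q⁺ (inj₂ v∈s))
    ... | inj₂ (Fin.suc a , v∈a) = inj₂ (a , v∈a)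

  weak-∷⁺ : ∀ {x U s} {W : Vec (Subset n) x} → IsDownSet D U →
            IsNextBlock U s → IsWeakDComposition (U ∪ s) W → IsWeakDComposition U (s ∷ W)
  weak-∷⁺ {U = U} {s} {W} down (s-outside , down∪ , s-inversionFree) weak = record
    { outside = outside′ ; disjoint = disjoint′ ; covers = covers′ ; downSet = down
    ; monotone = monotone′ ; inversionFree = inversionFree′ }
    where
    outside′ : ∀ v a → v ∈ U → v ∉ lookup (s ∷ W) a
    outside′ v Fin.zero    v∈U = s-outside v v∈U
    outside′ v (Fin.suc a) v∈U = outside weak v a (x∈p∪q⁺ (inj₁ v∈U))
    disjoint′ : ∀ a b v → v ∈ lookup (s ∷ W) a → v ∈ lookup (s ∷ W) b → a ≡ b
    disjoint′ Fin.zero    Fin.zero    v _   _   = refl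
    disjoint′ Fin.zero    (Fin.suc b) v v∈s v∈b = ⊥-elim (outside weak v b (x∈p∪q⁺ (inj₂ v∈s)) v∈b)
    disjoint′ (Fin.suc a) Fin.zero    v v∈a v∈s = ⊥-elim (outside weak v a (x∈p∪q⁺ (inj₂ v∈s)) v∈a)
    disjoint′ (Fin.suc a) (Fin.suc b) v v∈a v∈b = cong Fin.suc (disjoint weak a b v v∈a v∈b)
    covers′ : ∀ v → v ∈ U ⊎ ∃ λ a → v ∈ lookup (s ∷ W) a
    covers′ v with covers weak v
    ... | inj₂ (a , v∈a) = inj₂ (Fin.suc a , v∈a)
    ... | inj₁ v∈U∪s with x∈p∪q⁻ U s v∈U∪s
    ...   | inj₁ v∈U = inj₁ v∈U
    ...   | inj₂ v∈s = inj₂ (Fin.zero , v∈s)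
    monotone′ : ∀ i j a b → _≤₁_ D i j → i ∈ lookup (s ∷ W) a → j ∈ lookup (s ∷ W) b → a Fin.≤ b
    monotone′ i j Fin.zero    b           _   _   _   = z≤n
    monotone′ i j (Fin.suc a) Fin.zero    i≤j i∈a j∈s =
      ⊥-elim (outside weak i a (down∪ i j (x∈p∪q⁺ (inj₂ j∈s)) i≤j) i∈a)
    monotone′ i j (Fin.suc a) (Fin.suc b) i≤j i∈a j∈b = s≤s (monotone weak i j a b i≤j i∈a j∈b)
    inversionFree′ : ∀ a i j → i ∈ lookup (s ∷ W) a → j ∈ lookup (s ∷ W) a → ¬ Inversion D i j
    inversionFree′ Fin.zero    = s-inversionFree
    inversionFree′ (Fin.suc a) = inversionFree weak a

  weak-size : ∀ {x U} {W : Vec (Subset n) x} → IsWeakDComposition U W → ∣ U ∣ + sum (type D W) ≡ n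
  weak-size {U = U} {[]} weak = trans (ℕ.+-identityʳ ∣ U ∣) (∣p∣≡n U in-U)
    where
    in-U : ∀ v → v ∈ U
    in-U v with covers weak v
    ... | inj₁ v∈U = v∈U
  weak-size {U = U} {s ∷ W} weak with (s-outside , _) , weak′ ← weak-∷⁻ weak = begin
    ∣ U ∣ + (∣ s ∣ + sum (type D W))  ≡⟨ ℕ.+-assoc ∣ U ∣ ∣ s ∣ _ ⟨
    (∣ U ∣ + ∣ s ∣) + sum (type D W)  ≡⟨ cong (_+ sum (type D W)) (∣p∪q∣≡∣p∣+∣q∣ U s s-outside) ⟨
    ∣ U ∪ s ∣ + sum (type D W)        ≡⟨ weak-size weak′ ⟩
    n                                 ∎
    where open ≡-Reasoning

  ⊥-isDownSet : IsDownSet D ⊥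
  ⊥-isDownSet _ _ w∈⊥ _ = ⊥-elim (∉⊥ w∈⊥)

  type-positive : ∀ {k} (W : Vec (Subset n) k) → All (0 <_) (type D W) ⇔ (∀ i → Nonempty (lookup W i))
  type-positive W = mk⇔ (to W) (from W)
    where
    to : ∀ {k} (W : Vec (Subset n) k) → All (0 <_) (type D W) → ∀ i → Nonempty (lookup W i)
    to (s ∷ W) (∣s∣>0 ∷ _)   Fin.zero    = ∣p∣>0⇒nonempty s ∣s∣>0
    to (s ∷ W) (_     ∷ pos) (Fin.suc i) = to W pos i
    from : ∀ {k} (W : Vec (Subset n) k) → (∀ i → Nonempty (lookup W i)) → All (0 <_) (type D W)
    from []      _        = []
    from (s ∷ W) nonempty = nonempty⇒∣p∣>0 (nonempty Fin.zero) ∷ from W (nonempty ∘ Fin.suc)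

  type-isBoundedList : ∀ {x} (W : Vec (Subset n) x) → IsBoundedList x n (type D W)
  type-isBoundedList []      = refl , []
  type-isBoundedList (s ∷ W) with ∣type∣≡x , type≤n ← type-isBoundedList W =
    cong suc ∣type∣≡x , ∣p∣≤n s ∷ type≤n

  dSetComposition⇔ : ∀ {k} (W : Vec (Subset n) k) →
                     IsDSetComposition D W ⇔ (All (0 <_) (type D W) × IsWeakDComposition ⊥ W)
  dSetComposition⇔ {k} W = mk⇔
    (λ ((nonempty , disjoint′ , covers′) , prefix-down , inversionFree′) →
      Equivalence.from (type-positive W) nonempty , record
        { outside = λ _ _ v∈⊥ → ⊥-elim (∉⊥ v∈⊥) ; disjoint = disjoint′ ; covers = inj₂ ∘ covers′
        ; downSet = ⊥-isDownSet ; monotone = monotone′ prefix-down disjoint′ ; inversionFree = inversionFree′ })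
    (λ (pos , weak) →
      (Equivalence.to (type-positive W) pos , disjoint weak , covers′ weak) , prefix-down weak , inversionFree weak)
    where
    monotone′ : (∀ (p : Fin (suc k)) → IsDownSet D (⋃ (take (toℕ p) (toList W)))) →
                (∀ a b v → v ∈ lookup W a → v ∈ lookup W b → a ≡ b) →
                ∀ i j a b → _≤₁_ D i j → i ∈ lookup W a → j ∈ lookup W b → a Fin.≤ b
    monotone′ prefix-down disjoint′ i j a b i≤j i∈a j∈b
      with a′ , a′≤b , i∈a′ ← ∈-⋃-take⁻ W (suc (toℕ b))
             (prefix-down (Fin.suc b) i j (∈-⋃-take⁺ W (suc (toℕ b)) b ℕ.≤-refl j∈b) i≤j)
      = subst (λ c → toℕ c ≤ toℕ b) (disjoint′ a′ a i i∈a′ i∈a) (s≤s⁻¹ a′≤b)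
    covers′ : IsWeakDComposition ⊥ W → ∀ v → ∃ λ a → v ∈ lookup W a
    covers′ weak v with covers weak v
    ... | inj₁ v∈⊥ = ⊥-elim (∉⊥ v∈⊥)
    ... | inj₂ v∈W = v∈W
    prefix-down : IsWeakDComposition ⊥ W → ∀ (p : Fin (suc k)) → IsDownSet D (⋃ (take (toℕ p) (toList W)))
    prefix-down weak p v w w∈ v≤w
      with b , b<p , w∈b ← ∈-⋃-take⁻ W (toℕ p) w∈ | a , v∈a ← covers′ weak v
      = ∈-⋃-take⁺ W (toℕ p) a (ℕ.≤-<-trans (monotone weak v w a b v≤w v∈a w∈b) b<p) v∈a

  type-isComposition : ∀ {k} (W : Vec (Subset n) k) → IsDSetComposition D W → IsComposition n (type D W)
  type-isComposition W dsc with pos , weak ← Equivalence.to (dSetComposition⇔ W) dsc =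
    pos , trans (cong (_+ sum (type D W)) (sym (∣⊥∣≡0 n))) (weak-size weak)

  weak⊥⇒weakSetComposition : ∀ {x} {W : Vec (Subset n) x} → IsWeakDComposition ⊥ W → IsWeakSetComposition W
  weak⊥⇒weakSetComposition weak v with covers weak v
  ... | inj₁ v∈⊥       = ⊥-elim (∉⊥ v∈⊥)
  ... | inj₂ (a , v∈a) = (a , Vec.[]=⇒lookup v∈a) , λ i j v∈i v∈j →
    disjoint weak i j v (Vec.lookup⇒[]= v _ v∈i) (Vec.lookup⇒[]= v _ v∈j)

  dPartition⇔ : ∀ {x} (f : Fin n → Fin x) → IsDPartition D f ⇔ IsWeakDComposition ⊥ (fibres f)
  dPartition⇔ f = mk⇔
    (λ dp → record
      { outside       = λ _ _ v∈⊥ → ⊥-elim (∉⊥ v∈⊥)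
      ; disjoint      = λ _ _ _ v∈a v∈b → trans (sym (∈-fibres⁻ f v∈a)) (∈-fibres⁻ f v∈b)
      ; covers        = λ v → inj₂ (f v , ∈-fibres⁺ f refl)
      ; downSet       = ⊥-isDownSet
      ; monotone      = λ i j _ _ i≤j i∈a j∈b →
          subst₂ Fin._≤_ (∈-fibres⁻ f i∈a) (∈-fibres⁻ f j∈b) (proj₁ (dp i j) i≤j)
      ; inversionFree = λ _ i j i∈a j∈a (i<j , j<i) →
          Fin.<-irrefl (trans (∈-fibres⁻ f i∈a) (sym (∈-fibres⁻ f j∈a))) (proj₂ (dp i j) i<j j<i)
      })
    (λ weak i j →
      (λ i≤j → monotone weak i j (f i) (f j) i≤j (∈-fibres⁺ f refl) (∈-fibres⁺ f refl)) ,
      (λ i<j j<i → Fin.≤∧≢⇒< (monotone weak i j (f i) (f j) (proj₁ i<j) (∈-fibres⁺ f refl) (∈-fibres⁺ f refl))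
                             λ fi≡fj → inversionFree weak (f i) i j (∈-fibres⁺ f refl) (∈-fibres⁺ f (sym fi≡fj))
                                                     (i<j , j<i)))

  hasContent⇔ : ∀ m (f : Fin n → Fin (length m)) → HasContent D m f ⇔ type D (fibres f) ≡ m
  hasContent⇔ m f = mk⇔
    (λ content → trans type≡ (Equivalence.from (toList-tabulate-≡ m (∣_∣ ∘ fibre D f)) content))
    (λ type≡m → Equivalence.to (toList-tabulate-≡ m (∣_∣ ∘ fibre D f)) (trans (sym type≡) type≡m))
    where
    type≡ : type D (fibres f) ≡ toList (tabulate (∣_∣ ∘ fibre D f))
    type≡ = cong toList (sym (Vec.tabulate-∘ ∣_∣ (fibre D f)))

  module _ (g : Permutation′ n) where

    act-fibres : ∀ {x} (f : Fin n → Fin x) → act D g (fibres f) ≡ fibres (f ∘ (g ⟨$⟩ˡ_))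
    act-fibres f = trans (sym (Vec.tabulate-∘ (image D g) (fibre D f)))
                         (Vec.tabulate-cong λ i → Vec.tabulate-cong λ w → Vec.lookup∘tabulate _ (g ⟨$⟩ˡ w))

    fixedBy⇔ : ∀ {x} (f : Fin n → Fin x) → FixedBy D g f ⇔ act D g (fibres f) ≡ fibres f
    fixedBy⇔ f = mk⇔
      (λ fixed → trans (act-fibres f) (Equivalence.from (fibres-≡ (f ∘ (g ⟨$⟩ˡ_)) f)
         λ w → trans (sym (fixed (g ⟨$⟩ˡ w))) (cong f (inverseʳ g))))
      (λ gf≡f v → trans (sym (Equivalence.to (fibres-≡ (f ∘ (g ⟨$⟩ˡ_)) f) (trans (sym (act-fibres f)) gf≡f)
                                                (g ⟨$⟩ʳ v)))
                        (cong f (inverseˡ g)))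

    FixedWeak : ∀ {x} → Subset n → Vec (Subset n) x → Set
    FixedWeak U W = IsWeakDComposition U W × act D g W ≡ W

    fixedWeak? : ∀ {x} U (W : Vec (Subset n) x) → Dec (FixedWeak U W)
    fixedWeak? U W = isWeakDComposition? U W ×-dec actFixed? D g W

    FixedOfType : ∀ {x} → Subset n → List ℕ → Vec (Subset n) x → Set
    FixedOfType U m W = FixedWeak U W × type D W ≡ m

    fixedOfType? : ∀ {x} U m (W : Vec (Subset n) x) → Dec (FixedOfType U m W)
    fixedOfType? U m W = fixedWeak? U W ×-dec (type D W ≟ˡ m)

    weakCount : Subset n → ℕ → List ℕ → ℕ
    weakCount U x m = count (fixedOfType? U m) (allSubsetVecs n x)

    FixedBlock : Subset n → Subset n → ℕ → Set
    FixedBlock U s a = IsNextBlock U s × image D g s ≡ s × ∣ s ∣ ≡ a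

    fixedBlock? : ∀ U s a → Dec (FixedBlock U s a)
    fixedBlock? U s a = isNextBlock? U s ×-dec (image D g s ≟ˢ s) ×-dec (∣ s ∣ ℕ.≟ a)

    fixedOfType-∷ : ∀ {x U s a m} {W : Vec (Subset n) x} → IsDownSet D U →
                    FixedOfType U (a ∷ m) (s ∷ W) ⇔ (FixedBlock U s a × FixedOfType (U ∪ s) m W)
    fixedOfType-∷ down = mk⇔
      (λ ((weak , gW≡W) , type≡) → let next , weak′ = weak-∷⁻ weak in
         (next , Vec.∷-injectiveˡ gW≡W , List.∷-injectiveˡ type≡)
         , (weak′ , Vec.∷-injectiveʳ gW≡W) , List.∷-injectiveʳ type≡)
      (λ ((next , gs≡s , ∣s∣≡a) , (weak′ , gW≡W) , type≡) →
         (weak-∷⁺ down next weak′ , cong₂ _∷_ gs≡s gW≡W) , cong₂ _∷_ ∣s∣≡a type≡)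

    weakCount-∷ : ∀ {U} x a m → IsDownSet D U →
      weakCount U (suc x) (a ∷ m) ≡ ∑ (allSubsets n) (λ s → 𝟙 (fixedBlock? U s a) * weakCount (U ∪ s) x m)
    weakCount-∷ {U} x a m down = begin
      weakCount U (suc x) (a ∷ m)
        ≡⟨ count≡∑𝟙 (fixedOfType? U (a ∷ m)) (allSubsetVecs n (suc x)) ⟩
      ∑ (allSubsetVecs n (suc x)) (𝟙 ∘ fixedOfType? U (a ∷ m))
        ≡⟨ ∑-pairs _∷_ (allSubsets n) (allSubsetVecs n x) (𝟙 ∘ fixedOfType? U (a ∷ m)) ⟩
      ∑ (allSubsetVecs n x) (λ W → ∑ (allSubsets n) (λ s → 𝟙 (fixedOfType? U (a ∷ m) (s ∷ W))))
        ≡⟨ ∑-cong (λ W → ∑-cong (λ s → split s W) (allSubsets n)) (allSubsetVecs n x) ⟩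
      ∑ (allSubsetVecs n x) (λ W → ∑ (allSubsets n) (λ s → 𝟙 (fixedBlock? U s a) * 𝟙 (fixedOfType? (U ∪ s) m W)))
        ≡⟨ ∑-swap (allSubsetVecs n x) (allSubsets n) _ ⟩
      ∑ (allSubsets n) (λ s → ∑ (allSubsetVecs n x) (λ W → 𝟙 (fixedBlock? U s a) * 𝟙 (fixedOfType? (U ∪ s) m W)))
        ≡⟨ ∑-cong (λ s → ∑-*ˡ (allSubsetVecs n x) (𝟙 (fixedBlock? U s a)) _) (allSubsets n) ⟩
      ∑ (allSubsets n) (λ s → 𝟙 (fixedBlock? U s a) * ∑ (allSubsetVecs n x) (𝟙 ∘ fixedOfType? (U ∪ s) m))
        ≡⟨ ∑-cong (λ s → cong (𝟙 (fixedBlock? U s a) *_) (count≡∑𝟙 (fixedOfType? (U ∪ s) m) (allSubsetVecs n x)))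
                  (allSubsets n) ⟨
      ∑ (allSubsets n) (λ s → 𝟙 (fixedBlock? U s a) * weakCount (U ∪ s) x m) ∎
      where
      open ≡-Reasoning
      split : ∀ s W → 𝟙 (fixedOfType? U (a ∷ m) (s ∷ W)) ≡ 𝟙 (fixedBlock? U s a) * 𝟙 (fixedOfType? (U ∪ s) m W)
      split s W = trans (𝟙-cong (fixedOfType-∷ down) (fixedOfType? U (a ∷ m) (s ∷ W))
                                (fixedBlock? U s a ×-dec fixedOfType? (U ∪ s) m W))
                        (𝟙-× (fixedBlock? U s a) (fixedOfType? (U ∪ s) m W))

    image-⊥ : image D g ⊥ ≡ ⊥
    image-⊥ = trans (Vec.tabulate-cong λ w → trans (Vec.lookup-replicate (g ⟨$⟩ˡ w) false)
                                                   (sym (Vec.lookup-replicate w false)))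
                    (Vec.tabulate∘lookup ⊥)

    fixedBlock-0 : ∀ {U} s → IsDownSet D U → FixedBlock U s 0 ⇔ ⊥ ≡ s
    fixedBlock-0 {U} s down = mk⇔
      (λ (_ , _ , ∣s∣≡0) → sym (∣p∣≡0⇒p≡⊥ ∣s∣≡0))
      (λ { refl → ((λ _ _ → ∉⊥) , subst (IsDownSet D) (sym (∪-identityʳ U)) down , λ _ _ i∈⊥ → ⊥-elim (∉⊥ i∈⊥))
                , image-⊥ , ∣⊥∣≡0 n })

    weakCount-0∷ : ∀ {U} x m → IsDownSet D U → weakCount U (suc x) (0 ∷ m) ≡ weakCount U x m
    weakCount-0∷ {U} x m down = begin
      weakCount U (suc x) (0 ∷ m)
        ≡⟨ weakCount-∷ x 0 m down ⟩
      ∑ (allSubsets n) (λ s → 𝟙 (fixedBlock? U s 0) * weakCount (U ∪ s) x m)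
        ≡⟨ ∑-cong (λ s → cong (_* weakCount (U ∪ s) x m)
                              (𝟙-cong (fixedBlock-0 s down) (fixedBlock? U s 0) (⊥ ≟ˢ s))) (allSubsets n) ⟩
      ∑ (allSubsets n) (λ s → 𝟙 (⊥ ≟ˢ s) * weakCount (U ∪ s) x m)
        ≡⟨ ∑-sift _≟ˢ_ ⊥ (allSubsets n) (λ s → weakCount (U ∪ s) x m) ⟩
      occurrences _≟ˢ_ ⊥ (allSubsets n) * weakCount (U ∪ ⊥) x m
        ≡⟨ cong₂ _*_ (occurrences-allSubsets n ⊥) (cong (λ V → weakCount V x m) (∪-identityʳ U)) ⟩
      1 * weakCount U x m
        ≡⟨ ℕ.*-identityˡ _ ⟩
      weakCount U x m ∎
      where open ≡-Reasoning

    weakCount-nonzeroExps : ∀ {U} m → IsDownSet D U →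
      weakCount U (length m) m ≡ weakCount U (length (nonzeroExps m)) (nonzeroExps m)
    weakCount-nonzeroExps []              down = refl
    weakCount-nonzeroExps (zero ∷ m)      down = trans (weakCount-0∷ (length m) m down) (weakCount-nonzeroExps m down)
    weakCount-nonzeroExps {U} (suc a ∷ m) down = begin
      weakCount U (suc (length m)) (suc a ∷ m)
        ≡⟨ weakCount-∷ (length m) (suc a) m down ⟩
      ∑ (allSubsets n) (λ s → 𝟙 (fixedBlock? U s (suc a)) * weakCount (U ∪ s) (length m) m)
        ≡⟨ ∑-cong (λ s → 𝟙*-congˡ (fixedBlock? U s (suc a))
                                  λ ((_ , down′ , _) , _) → weakCount-nonzeroExps m down′) (allSubsets n) ⟩
      ∑ (allSubsets n) (λ s → 𝟙 (fixedBlock? U s (suc a)) * weakCount (U ∪ s) (length (nonzeroExps m)) (nonzeroExps m))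
        ≡⟨ weakCount-∷ (length (nonzeroExps m)) (suc a) (nonzeroExps m) down ⟨
      weakCount U (suc (length (nonzeroExps m))) (suc a ∷ nonzeroExps m) ∎
      where open ≡-Reasoning

    fixedWeak⇔ : ∀ {x} (f : Fin n → Fin x) → (IsDPartition D f × FixedBy D g f) ⇔ FixedWeak ⊥ (fibres f)
    fixedWeak⇔ f = dPartition⇔ f ×-⇔ fixedBy⇔ f

    fixedOfType⇔ : ∀ m (f : Fin n → Fin (length m)) →
                   (IsDPartition D f × FixedBy D g f × HasContent D m f) ⇔ FixedOfType ⊥ m (fibres f)
    fixedOfType⇔ m f = ⇔.trans (mk⇔ (λ (dp , fixed , content) → (dp , fixed) , content)
                                    (λ ((dp , fixed) , content) → dp , fixed , content))
                               (fixedWeak⇔ f ×-⇔ hasContent⇔ m f)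

    Ω≡weakCount : ∀ m → Ω D g m ≡ weakCount ⊥ (length m) m
    Ω≡weakCount m = trans
      (count-cong (λ f → isDPartition? D f ×-dec (fixedBy? D g f ×-dec hasContent? D m f)) (fixedOfType? ⊥ m ∘ fibres)
                  (fixedOfType⇔ m) (allFuns n (length m)))
      (count-via-fibres n (length m) (fixedOfType? ⊥ m) (λ _ ((weak , _) , _) → weak⊥⇒weakSetComposition weak))

    Ωₓ≡∑weakCount : ∀ x → Ωₓ D x g ≡ ∑ (allLists x n) (weakCount ⊥ x)
    Ωₓ≡∑weakCount x = begin
      Ωₓ D x g
        ≡⟨ count-cong (λ f → isDPartition? D f ×-dec fixedBy? D g f) (fixedWeak? ⊥ ∘ fibres) fixedWeak⇔ (allFuns n x) ⟩
      count (fixedWeak? ⊥ ∘ fibres) (allFuns n x)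
        ≡⟨ count-via-fibres n x (fixedWeak? ⊥) (λ _ (weak , _) → weak⊥⇒weakSetComposition weak) ⟩
      count (fixedWeak? ⊥) (allSubsetVecs n x)
        ≡⟨ count≡∑𝟙 (fixedWeak? ⊥) (allSubsetVecs n x) ⟩
      ∑ (allSubsetVecs n x) (𝟙 ∘ fixedWeak? ⊥)
        ≡⟨ ∑-cong by-type (allSubsetVecs n x) ⟨
      ∑ (allSubsetVecs n x) (λ W → ∑ (allLists x n) (λ m → 𝟙 (fixedOfType? ⊥ m W)))
        ≡⟨ ∑-swap (allSubsetVecs n x) (allLists x n) _ ⟩
      ∑ (allLists x n) (λ m → ∑ (allSubsetVecs n x) (𝟙 ∘ fixedOfType? ⊥ m))
        ≡⟨ ∑-cong (λ m → count≡∑𝟙 (fixedOfType? ⊥ m) (allSubsetVecs n x)) (allLists x n) ⟨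
      ∑ (allLists x n) (weakCount ⊥ x) ∎
      where
      open ≡-Reasoning
      by-type : ∀ W → ∑ (allLists x n) (λ m → 𝟙 (fixedOfType? ⊥ m W)) ≡ 𝟙 (fixedWeak? ⊥ W)
      by-type W = begin
        ∑ (allLists x n) (λ m → 𝟙 (fixedOfType? ⊥ m W))
          ≡⟨ ∑-cong (λ m → 𝟙-× (fixedWeak? ⊥ W) (type D W ≟ˡ m)) (allLists x n) ⟩
        ∑ (allLists x n) (λ m → 𝟙 (fixedWeak? ⊥ W) * 𝟙 (type D W ≟ˡ m))
          ≡⟨ ∑-*ˡ (allLists x n) (𝟙 (fixedWeak? ⊥ W)) _ ⟩
        𝟙 (fixedWeak? ⊥ W) * occurrences _≟ˡ_ (type D W) (allLists x n)
          ≡⟨ cong (𝟙 (fixedWeak? ⊥ W) *_) (trans (occurrences-allLists x n (type D W))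
                                                    (𝟙-yes (isBoundedList? x n (type D W)) (type-isBoundedList W))) ⟩
        𝟙 (fixedWeak? ⊥ W) * 1
          ≡⟨ ℕ.*-identityʳ _ ⟩
        𝟙 (fixedWeak? ⊥ W) ∎

    Ωₓ≡∑Ω : ∀ x → Ωₓ D x g ≡ ∑ (allLists x n) (Ω D g)
    Ωₓ≡∑Ω x = trans (Ωₓ≡∑weakCount x) (∑-cong-All (All.map at-length-x (allLists-length x n)))
      where
      at-length-x : ∀ {m} → length m ≡ x → weakCount ⊥ x m ≡ Ω D g m
      at-length-x {m} refl = sym (Ω≡weakCount m)

    χ≡weakCount : ∀ β → All (0 <_) β → χ D β g ≡ weakCount ⊥ (length β) β
    χ≡weakCount β 0<β = count-cong
      (λ W → isDSetComposition? D W ×-dec (actFixed? D g W ×-dec (type D W ≟ˡ β))) (fixedOfType? ⊥ β)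
      (λ W → mk⇔ (λ (dsc , fixed , type≡β) → (proj₂ (Equivalence.to (dSetComposition⇔ W) dsc) , fixed) , type≡β)
                 (λ ((weak , fixed) , type≡β) →
                    Equivalence.from (dSetComposition⇔ W) (subst (All (0 <_)) (sym type≡β) 0<β , weak) , fixed , type≡β))
      (allSubsetVecs n (length β))

    Ω≡χ : ∀ m → Ω D g m ≡ χ D (nonzeroExps m) g
    Ω≡χ m = begin
      Ω D g m                                                   ≡⟨ Ω≡weakCount m ⟩
      weakCount ⊥ (length m) m                                ≡⟨ weakCount-nonzeroExps m ⊥-isDownSet ⟩
      weakCount ⊥ (length (nonzeroExps m)) (nonzeroExps m)    ≡⟨ χ≡weakCount (nonzeroExps m) (nonzeroExps-positive m) ⟨
      χ D (nonzeroExps m) g                                     ∎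
      where open ≡-Reasoning

    χ≢0⇒composition : ∀ β → ¬ χ D β g ≡ 0 → IsComposition n β
    χ≢0⇒composition β χ≢0 with W , dsc , _ , type≡β ← count≢0⇒∃ _ (allSubsetVecs n (length β)) χ≢0 =
      subst (IsComposition n) type≡β (type-isComposition W dsc)

    -- χ_{β,D} vanishes unless β ⊨ n.
    𝟙*χ≡χ : ∀ {P : Set} (p : Dec P) β → (IsComposition n β → P) → 𝟙 p * χ D β g ≡ χ D β g
    𝟙*χ≡χ p β composition⇒P with χ D β g ℕ.≟ 0
    ... | yes χ≡0 = trans (cong (𝟙 p *_) χ≡0) (trans (ℕ.*-zeroʳ (𝟙 p)) (sym χ≡0))
    ... | no χ≢0  =
      trans (cong (_* χ D β g) (𝟙-yes p (composition⇒P (χ≢0⇒composition β χ≢0)))) (ℕ.*-identityˡ _)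

    ∑-fixedDSetCompositions : ∀ m k → ∑ (fixedDSetCompositions D g k) (λ W → M (type D W) m)
                                      ≡ 𝟙 (length (nonzeroExps m) ℕ.≟ k) * χ D (nonzeroExps m) g
    ∑-fixedDSetCompositions m k = begin
      ∑ (filter fixedDSC? (allSubsetVecs n k)) (λ W → M (type D W) m)
        ≡⟨ ∑-filter fixedDSC? (allSubsetVecs n k) (λ W → M (type D W) m) ⟩
      ∑ (allSubsetVecs n k) (λ W → 𝟙 (fixedDSC? W) * M (type D W) m)
        ≡⟨ ∑-cong (λ W → cong (𝟙 (fixedDSC? W) *_) (M≡𝟙 (type D W) m)) (allSubsetVecs n k) ⟩
      ∑ (allSubsetVecs n k) (λ W → 𝟙 (fixedDSC? W) * 𝟙 (β ≟ˡ type D W))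
        ≡⟨ ∑-cong (λ W → trans (sym (𝟙-× (fixedDSC? W) (β ≟ˡ type D W)))
                               (𝟙-cong reassociate (fixedDSC? W ×-dec β ≟ˡ type D W) (ofType? W)))
                  (allSubsetVecs n k) ⟩
      ∑ (allSubsetVecs n k) (𝟙 ∘ ofType?)
        ≡⟨ by-length (length β ℕ.≟ k) ⟩
      𝟙 (length β ℕ.≟ k) * χ D β g ∎
      where
      open ≡-Reasoning
      β = nonzeroExps m
      fixedDSC? : ∀ (W : Vec (Subset n) k) → Dec (IsDSetComposition D W × act D g W ≡ W)
      fixedDSC? W = isDSetComposition? D W ×-dec actFixed? D g W
      ofType? : ∀ (W : Vec (Subset n) k) → Dec (IsDSetComposition D W × act D g W ≡ W × type D W ≡ β)
      ofType? W = isDSetComposition? D W ×-dec (actFixed? D g W ×-dec (type D W ≟ˡ β))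
      reassociate : ∀ {A B : Set} {W} → ((A × B) × β ≡ W) ⇔ (A × B × W ≡ β)
      reassociate = mk⇔ (λ ((a , b) , β≡W) → a , b , sym β≡W) (λ (a , b , W≡β) → (a , b) , sym W≡β)
      by-length : (ℓ≟k : Dec (length β ≡ k)) → ∑ (allSubsetVecs n k) (𝟙 ∘ ofType?) ≡ 𝟙 ℓ≟k * χ D β g
      by-length (yes refl) = trans (sym (count≡∑𝟙 ofType? (allSubsetVecs n k))) (sym (ℕ.*-identityˡ _))
      by-length (no ℓ≢k)   = ∑-0 (allSubsetVecs n k) λ W →
        𝟙-no (ofType? W) λ (_ , _ , type≡β) →
          ℓ≢k (trans (cong length (sym type≡β)) (proj₁ (type-isBoundedList W)))

    Ω≡ΣfixedM : ∀ m → Ω D g m ≡ ΣfixedM D g m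
    Ω≡ΣfixedM m = begin
      Ω D g m
        ≡⟨ Ω≡χ m ⟩
      χ D β g
        ≡⟨ 𝟙*χ≡χ (length β ℕ.<? suc n) β
                 (λ (0<β , Σβ≡n) → s≤s (subst (length β ≤_) Σβ≡n (length≤sum β 0<β))) ⟨
      𝟙 (length β ℕ.<? suc n) * χ D β g
        ≡⟨ cong (_* χ D β g) (occurrences-upTo (suc n) (length β)) ⟨
      occurrences ℕ._≟_ (length β) (upTo (suc n)) * χ D β g
        ≡⟨ ∑-*ʳ (upTo (suc n)) (χ D β g) (λ k → 𝟙 (length β ℕ.≟ k)) ⟨
      ∑ (upTo (suc n)) (λ k → 𝟙 (length β ℕ.≟ k) * χ D β g)
        ≡⟨ ∑-cong (∑-fixedDSetCompositions m) (upTo (suc n)) ⟨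
      ΣfixedM D g m ∎
      where
      open ≡-Reasoning
      β = nonzeroExps m

    Ω≡∑χM : ∀ m → Ω D g m ≡ ΣPS (compositions n) (λ α → χ D α g ·PS M α) m
    Ω≡∑χM m = begin
      Ω D g m
        ≡⟨ Ω≡χ m ⟩
      χ D β g
        ≡⟨ 𝟙*χ≡χ (isComposition? n β) β (λ composition → composition) ⟨
      𝟙 (isComposition? n β) * χ D β g
        ≡⟨ cong (_* χ D β g) (occurrences-compositions n β) ⟨
      occurrences _≟ˡ_ β (compositions n) * χ D β g
        ≡⟨ ∑-sift _≟ˡ_ β (compositions n) (λ α → χ D α g) ⟨
      ∑ (compositions n) (λ α → 𝟙 (β ≟ˡ α) * χ D α g)
        ≡⟨ ∑-cong (λ α → trans (ℕ.*-comm _ (χ D α g)) (cong (χ D α g *_) (sym (M≡𝟙 α m)))) (compositions n) ⟩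
      ∑ (compositions n) (λ α → χ D α g * M α m) ∎
      where
      open ≡-Reasoning
      β = nonzeroExps m

    Ωₓ≡∑χC : ∀ x → Ωₓ D x g ≡ ∑ (compositions n) (λ α → χ D α g * (x C ℓ α))
    Ωₓ≡∑χC x = begin
      Ωₓ D x g
        ≡⟨ Ωₓ≡∑Ω x ⟩
      ∑ (allLists x n) (Ω D g)
        ≡⟨ ∑-cong Ω≡∑χM (allLists x n) ⟩
      ∑ (allLists x n) (λ m → ∑ (compositions n) (λ α → χ D α g * M α m))
        ≡⟨ ∑-swap (allLists x n) (compositions n) _ ⟩
      ∑ (compositions n) (λ α → ∑ (allLists x n) (λ m → χ D α g * M α m))
        ≡⟨ ∑-cong (λ α → ∑-*ˡ (allLists x n) (χ D α g) (M α)) (compositions n) ⟩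
      ∑ (compositions n) (λ α → χ D α g * ∑ (allLists x n) (M α))
        ≡⟨ ∑-cong-All (All.map specialise
                                (All.all-filter (isComposition? n) (concatMap (λ k → allLists k n) (upTo (suc n))))) ⟩
      ∑ (compositions n) (λ α → χ D α g * (x C ℓ α)) ∎
      where
      open ≡-Reasoning
      specialise : ∀ {α} → IsComposition n α → χ D α g * ∑ (allLists x n) (M α) ≡ χ D α g * (x C ℓ α)
      specialise {α} (0<α , Σα≡n) =
        cong (χ D α g *_) (∑-M-allLists x n α 0<α (subst (λ s → All (_≤ s) α) Σα≡n (All≤sum α)))

-- The identities hold for every permutation g.
theorem3p2 : ∀ {n : ℕ} (D : DoublePoset n) (𝔊 : SubgroupOfAut D) →
      -- (1)
      (∀ g → _∈𝔊 𝔊 g → Ω D g ≈PS ΣfixedM D g)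
      -- (2)
    × (∀ g → _∈𝔊 𝔊 g →
         Ω D g ≈PS ΣPS (compositions n) (λ α → χ D α g ·PS M α))
      -- (3)
    × (∀ (x : ℕ) → 0 < x → ∀ g → _∈𝔊 𝔊 g →
         Ωₓ D x g ≡ sum (map (λ α → χ D α g * (x C ℓ α)) (compositions n)))
theorem3p2 D 𝔊 =
  (λ g _ → Ω≡ΣfixedM D g) , (λ g _ → Ω≡∑χM D g) , (λ x _ g _ → Ωₓ≡∑χC D g x)
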